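{- Let $m\ge 2$, $n\ge 1$, $0\le p\le m-1$, and let $f^{TnC}_m(n)$, $f^{TG}_{m,p}(n)$, $f^{KB}_{m,p}(n)$ be the numbers of 2-factors of $TnC_m(n)$, $TG^{(p)}_m(n)$, $KB^{(p)}_m(n)$ respectively. Order the vertices of ${\cal D}_m$ as $v_1,v_2,\dots$ with $v_1=b^m$, let ${\cal T}_m=[a_{ij}]$ be the adjacency matrix of ${\cal D}_m$, write $a^{(k)}_{ij}$ for the $(i,j)$-entry of ${\cal T}_m^k$ (with ${\cal T}_m^0$ the identity), and let ${\cal H}_m$, ${\cal R}_m$ be the H-conversion and rotation matrices. Then $$f^{TnC}_m(n)=\sum_{v_i\in{\cal F}_m,\ v_j\in{\cal L}_m}a^{(n-1)}_{ij}=\sum_{v_i\in{\cal F}_m}a^{(n)}_{ii}=a^{(n+1)}_{11},$$ $$f^{TG}_{m,p}(n)=\mathrm{tr}({\cal T}_m^n{\cal R}_m^p)=\mathrm{tr}({\cal R}_m^p{\cal T}_m^n)=\sum_{v_i,v_j\in V({\cal D}_m),\ v_i=\rho^p(v_j)}a^{(n)}_{ij},$$ $$f^{KB}_{m,p}(n)=\mathrm{tr}({\cal T}_m^n{\cal R}_m^p{\cal H}_m)=\mathrm{tr}({\cal R}_m^p{\cal H}_m{\cal T}_m^n)=\sum_{v_i,v_j\in V({\cal D}_m),\ \overline{v_i}=\rho^p(v_j)}a^{(n)}_{ij}.$$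
   Context: Letters and digraphs: the alpha-letters are the 2-element subsets of $\{\text{up},\text{down},\text{left},\text{right}\}$: $a=\{\text{right},\text{down}\}$, $b=\{\text{up},\text{down}\}$, $c=\{\text{right},\text{up}\}$, $d=\{\text{left},\text{down}\}$, $e=\{\text{left},\text{right}\}$, $f=\{\text{left},\text{up}\}$; $\overline{\alpha}$ exchanges up and down ($a\leftrightarrow c$, $d\leftrightarrow f$, $b,e$ fixed). ${\cal D}_{ud}$: arc $(\alpha,\beta)$ iff ($\text{down}\in\alpha\iff\text{up}\in\beta$); ${\cal D}_{lr}$: arc $(\alpha,\beta)$ iff ($\text{right}\in\alpha\iff\text{left}\in\beta$). ${\cal D}_m$ is the digraph whose vertices are the words $\alpha=\alpha_1\cdots\alpha_m\in\{a,\dots,f\}^m$ with $(\alpha_i,\alpha_{i+1})$ an arc of ${\cal D}_{ud}$ for all $1\le i\le m$ ($\alpha_{m+1}:=\alpha_1$), with an arc $v\to u$ iff $(v_i,u_i)$ is an arc of ${\cal D}_{lr}$ for all $i$. For a word $\alpha$: $\rho(\alpha)=\alpha_2\cdots\alpha_m\alpha_1$ (rotation), $\rho^p(\alpha)=\alpha_{p+1}\cdots\alpha_m\alpha_1\cdots\alpha_p$, and $\overline{\alpha}=\overline{\alpha_m}\,\overline{\alpha_{m-1}}\cdots\overline{\alpha_1}$ (horizontal conversion). ${\cal R}_m=[r_{ij}]$ has $r_{ij}=1$ iff $v_j=\rho(v_i)$ and $0$ otherwise; ${\cal H}_m=[h_{ij}]$ has $h_{ij}=1$ iff $v_i=\overline{v_j}$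 and $0$ otherwise. ${\cal F}_m=V({\cal D}_m)\cap\{a,b,c\}^m$, ${\cal L}_m=V({\cal D}_m)\cap\{b,d,f\}^m$. Graphs: row indices mod $m$ in $\{1,\dots,m\}$. Multigraphs (loops/parallel edges allowed; for $m,n\ge3$ the usual simple grids) on $\{1,\dots,m\}\times\{1,\dots,n\}$ with directed edge-ends: vertical edges joining $(i,j)$ (end "down") to $(i+1,j)$ (end "up") for all $i,j$; horizontal edges joining $(i,j)$ (end "right") to $(i,j+1)$ (end "left") for $j\le n-1$. $TnC_m(n)=C_m\times P_n$ has only these; $TG^{(p)}_m(n)$ also has, for each $i$, an edge joining $(i+p,n)$ (right) to $(i,1)$ (left); $KB^{(p)}_m(n)$ also has, for each $i$, an edge joining $(m+p+1-i,n)$ (right) to $(i,1)$ (left). A 2-factor is a set of edges such that every vertex carries exactly two edge-ends of chosen edges (a loop contributes two). -}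

module Defs where

open import Data.Bool using (Bool; true; false; if_then_else_; _∧_; not)
open import Data.Nat using (ℕ; zero; suc; _+_; _*_; _∸_; _%_; _≡ᵇ_)
open import Data.Product using (_×_; _,_)
open import Data.List using (List; []; _∷_; map; concatMap; upTo; filterᵇ; length; zipWith; _++_)
open import Data.Vec using (Vec; []; _∷_; _∷ʳ_; replicate; reverse)
import Data.Vec as V
open import Function using (_∘_)
open import Data.Nat.ListAction using (sum)
open import Data.Bool.ListAction using (all)

-- Letters a..f as 2-element subsets of {up,down,left,right}

data Letter : Set where
  a b c d e f : Letter

hasUp hasDown hasLeft hasRight : Letter → Bool
hasUp a = false
hasUp b = true
hasUp c = true
hasUp d = false
hasUp e = false
hasUp f = true
hasDown a = true
hasDown b = true
hasDown c = false
hasDown d = true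
hasDown e = false
hasDown f = false
hasLeft a = false
hasLeft b = false
hasLeft c = false
hasLeft d = true
hasLeft e = true
hasLeft f = true
hasRight a = true
hasRight b = false
hasRight c = true
hasRight d = false
hasRight e = true
hasRight f = false

-- up/down exchange
bar : Letter → Letter
bar a = c
bar b = b
bar c = a
bar d = f
bar e = e
bar f = d

letters : List Letter
letters = a ∷ b ∷ c ∷ d ∷ e ∷ f ∷ []

eqBool : Bool → Bool → Bool
eqBool true true = true
eqBool false false = true
eqBool _ _ = false

eqL : Letter → Letter → Bool
eqL a a = true
eqL b b = true
eqL c c = true
eqL d d = true
eqL e e = true
eqL f f = true
eqL _ _ = false

udArc : Letter → Letter → Bool
udArc x y = eqBool (hasDown x) (hasUp y)

lrArc : Letter → Letter → Bool
lrArc x y = eqBool (hasRight x) (hasLeft y)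

Word : ℕ → Set
Word m = Vec Letter m

allWords : (m : ℕ) → List (Word m)
allWords zero = [] ∷ []
allWords (suc k) = concatMap (λ x → map (x ∷_) (allWords k)) letters

vAll : {m : ℕ} → (Letter → Letter → Bool) → Word m → Word m → Bool
vAll r u w = V.foldr _ _∧_ true (V.zipWith r u w)

eqW : {m : ℕ} → Word m → Word m → Bool
eqW = vAll eqL

rho : {m : ℕ} → Word m → Word m
rho [] = []
rho (x ∷ xs) = xs ∷ʳ x

rhoP : {m : ℕ} → ℕ → Word m → Word m
rhoP zero w = w
rhoP (suc k) w = rho (rhoP k w)

conv : {m : ℕ} → Word m → Word m
conv w = reverse (V.map bar w)

isVertex : {m : ℕ} → Word m → Bool
isVertex w = vAll udArc w (rho w)

verts : (m : ℕ) → List (Word m)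
verts m = filterᵇ isVertex (allWords m)

inLetters : List Letter → Letter → Bool
inLetters [] x = false
inLetters (y ∷ ys) x = if eqL x y then true else inLetters ys x

allIn : {m : ℕ} → List Letter → Word m → Bool
allIn S w = V.foldr _ _∧_ true (V.map (inLetters S) w)

Fm : (m : ℕ) → List (Word m)
Fm m = filterᵇ (allIn (a ∷ b ∷ c ∷ [])) (verts m)

Lm : (m : ℕ) → List (Word m)
Lm m = filterᵇ (allIn (b ∷ d ∷ f ∷ [])) (verts m)

Mat : ℕ → Set
Mat m = Word m → Word m → ℕ

ind : Bool → ℕ
ind true = 1
ind false = 0

idM : (m : ℕ) → Mat m
idM m u w = ind (eqW u w)

mulM : (m : ℕ) → Mat m → Mat m → Mat m
mulM m M N u w = sum (map (λ v → M u v * N v w) (verts m))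

powM : (m : ℕ) → Mat m → ℕ → Mat m
powM m M zero = idM m
powM m M (suc k) = mulM m (powM m M k) M

trM : (m : ℕ) → Mat m → ℕ
trM m M = sum (map (λ v → M v v) (verts m))

Tm : (m : ℕ) → Mat m
Tm m u w = ind (vAll lrArc u w)

Rm : (m : ℕ) → Mat m
Rm m u w = ind (eqW w (rho u))

Hm : (m : ℕ) → Mat m
Hm m u w = ind (eqW u (conv w))

aK : (m : ℕ) → ℕ → Word m → Word m → ℕ
aK m k = powM m (Tm m) k

bm : (m : ℕ) → Word m
bm m = replicate m b

-- Grid multigraphs and 2-factors
-- Vertices are (row , column), 0-indexed: rows 0..m-1, columns 0..n-1.
-- An edge is given by its two ends (a loop has both ends at the same vertex).

Pos : Set
Pos = ℕ × ℕ

Edge : Set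
Edge = Pos × Pos

modN : ℕ → ℕ → ℕ
modN x zero = x
modN x (suc k) = x % suc k

eqPos : Pos → Pos → Bool
eqPos (i , j) (k , l) = (i ≡ᵇ k) ∧ (j ≡ᵇ l)

vertEdges : ℕ → ℕ → List Edge
vertEdges m n = concatMap (λ i → map (λ j → ((i , j) , (modN (suc i) m , j))) (upTo n)) (upTo m)

horEdges : ℕ → ℕ → List Edge
horEdges m n = concatMap (λ i → map (λ j → ((i , j) , (i , suc j))) (upTo (n ∸ 1))) (upTo m)

-- TnC_m(n) = C_m × P_n
edgesTnC : ℕ → ℕ → List Edge
edgesTnC m n = vertEdges m n ++ horEdges m n

-- TG^{(p)}_m(n): for each row i (1-indexed), (i+p, n) -- (i, 1)
edgesTG : ℕ → ℕ → ℕ → List Edge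
edgesTG m p n = edgesTnC m n ++ map (λ i → ((modN (i + p) m , n ∸ 1) , (i , 0))) (upTo m)

-- KB^{(p)}_m(n): for each row i ∈ {1..m} (1-indexed), (m+p+1-i, n) -- (i, 1);
-- in 0-indexed rows with i₀ = i-1 the right end is row (m+p-(i₀+1)) mod m.
edgesKB : ℕ → ℕ → ℕ → List Edge
edgesKB m p n = edgesTnC m n ++ map (λ i → ((modN (m + p ∸ suc i) m , n ∸ 1) , (i , 0))) (upTo m)

selections : ℕ → List (List Bool)
selections zero = [] ∷ []
selections (suc k) = concatMap (λ s → (true ∷ s) ∷ (false ∷ s) ∷ []) (selections k)

endsAt : Pos → Edge → ℕ
endsAt v (x , y) = ind (eqPos v x) + ind (eqPos v y)

degree : List Edge → List Bool → Pos → ℕ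
degree E s v = sum (zipWith (λ chosen edge → if chosen then endsAt v edge else 0) s E)

gridVerts : ℕ → ℕ → List Pos
gridVerts m n = concatMap (λ i → map (λ j → (i , j)) (upTo n)) (upTo m)

isTwoFactor : ℕ → ℕ → List Edge → List Bool → Bool
isTwoFactor m n E s = all (λ v → degree E s v ≡ᵇ 2) (gridVerts m n)

numTwoFactors : ℕ → ℕ → List Edge → ℕ
numTwoFactors m n E = length (filterᵇ (isTwoFactor m n E) (selections (length E)))

fTnC : ℕ → ℕ → ℕ
fTnC m n = numTwoFactors m n (edgesTnC m n)

fTG : ℕ → ℕ → ℕ → ℕ
fTG m p n = numTwoFactors m n (edgesTG m p n)

fKB : ℕ → ℕ → ℕ → ℕ
fKB m p n = numTwoFactors m n (edgesKB m p n)

sumOver : {A : Set} → List A → (A → ℕ) → ℕ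
sumOver xs g = sum (map g xs)

sumPairsIf : (m : ℕ) → (Word m → Word m → Bool) → Mat m → ℕ
sumPairsIf m P M = sumOver (verts m) (λ u → sumOver (verts m) (λ w → if P u w then M u w else 0))

-- A 2-factor of an m × n grid picks two edge-ends at every vertex, i.e. one of the six letters a, …, f.
-- Reading column j from top to bottom gives a word; vertical edges are shared by consecutive rows
-- (cyclically), so the word is a vertex of D_m, and horizontal edges are shared by consecutive
-- columns, so consecutive columns are joined by an arc of D_m.  This is a bijection between
-- 2-factors and walks v₁ → ⋯ → v_n in D_m closed up by one more arc v_n → glue v₁: for TG and KB
-- the closing edges identify the right ends of the last column with the left ends of the first one
-- read through ρ^p (and through the conversion for KB); for TnC, glue = id and v₁ ∈ F_m, so the
-- closing arc just says v_n ∈ L_m.  Counting walks by powers of T_m gives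
-- f = Σ_x [x admissible] · (T_m^n)_{x, glue x}, and the trace forms follow from
-- (R_m^p)_{vu} = [u = ρ^p v] and (H_m)_{vu} = [v = conv u].

module Submission where

open import Data.Bool using (Bool; true; false; if_then_else_; _∧_; not; T)
open import Data.Bool.ListAction using (all)
open import Data.Nat
open import Data.Nat.DivMod
open import Data.Nat.Properties
open import Data.Nat.ListAction using (sum)
open import Data.Nat.ListAction.Properties using (sum-++)
open import Data.Nat.Tactic.RingSolver using (solve-∀)
open import Data.List
  using (List; []; _∷_; map; concat; concatMap; filterᵇ; length; _++_; applyUpTo; upTo; zipWith; take; drop)
import Data.List.Properties as List
open import Data.List.Relation.Unary.All as All using (All; []; _∷_)
open import Data.List.Relation.Unary.All.Properties using (concat⁺; concat⁻; map⁺; map⁻; applyUpTo⁻; all-upTo)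
open import Data.Product using (_×_; _,_; proj₁; proj₂)
open import Data.Sum using (inj₁; inj₂)
open import Data.Vec using ([]; _∷_; replicate; reverse)
import Data.Vec as Vec
import Data.Vec.Properties as Vec
open import Function using (_∘_; id)
open import Relation.Binary.PropositionalEquality
open ≡-Reasoning
open import Defs

bool-ext : ∀ {x y : Bool} → (x ≡ true → y ≡ true) → (y ≡ true → x ≡ true) → x ≡ y
bool-ext {true} {true} _ _ = refl
bool-ext {true} {false} x⇒y _ = sym (x⇒y refl)
bool-ext {false} {true} _ y⇒x = y⇒x refl
bool-ext {false} {false} _ _ = refl

∧-true : ∀ {x y} → (x ∧ y) ≡ true → x ≡ true × y ≡ true
∧-true {true} {true} _ = refl , refl

∧-intro : ∀ {x y} → x ≡ true → y ≡ true → (x ∧ y) ≡ true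
∧-intro refl refl = refl

∧-absorbˡ : ∀ x y → (x ≡ false → y ≡ false) → (x ∧ y) ≡ y
∧-absorbˡ true y _ = refl
∧-absorbˡ false y y-false = sym (y-false refl)

∧-congˡ : ∀ x {u v} → (x ≡ true → u ≡ v) → (x ∧ u) ≡ (x ∧ v)
∧-congˡ true eq = eq refl
∧-congˡ false _ = refl

if-true : ∀ {A : Set} {x} {p q : A} → x ≡ true → (if x then p else q) ≡ p
if-true refl = refl

≡ᵇ≡true⇒≡ : ∀ {x y} → (x ≡ᵇ y) ≡ true → x ≡ y
≡ᵇ≡true⇒≡ {x} {y} eq = ≡ᵇ⇒≡ x y (subst T (sym eq) _)

≡⇒≡ᵇ≡true : ∀ {x y} → x ≡ y → (x ≡ᵇ y) ≡ true
≡⇒≡ᵇ≡true {zero} refl = refl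
≡⇒≡ᵇ≡true {suc x} refl = ≡⇒≡ᵇ≡true {x} refl

<⇒<ᵇ≡true : ∀ {x y} → x < y → (x <ᵇ y) ≡ true
<⇒<ᵇ≡true {zero} (s≤s _) = refl
<⇒<ᵇ≡true {suc x} (s≤s x<y) = <⇒<ᵇ≡true x<y

<ᵇ≡false⇒≡ : ∀ j r → j ≤ r → (j <ᵇ r) ≡ false → j ≡ r
<ᵇ≡false⇒≡ zero zero _ _ = refl
<ᵇ≡false⇒≡ (suc j) (suc r) (s≤s j≤r) eq = cong suc (<ᵇ≡false⇒≡ j r j≤r eq)

<ᵇ≡not≡ᵇ : ∀ x y → x ≤ y → (x <ᵇ y) ≡ not (x ≡ᵇ y)
<ᵇ≡not≡ᵇ zero zero _ = refl
<ᵇ≡not≡ᵇ zero (suc y) _ = refl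
<ᵇ≡not≡ᵇ (suc x) (suc y) (s≤s x≤y) = <ᵇ≡not≡ᵇ x y x≤y

n<ᵇn≡false : ∀ x → (x <ᵇ x) ≡ false
n<ᵇn≡false zero = refl
n<ᵇn≡false (suc x) = n<ᵇn≡false x

ind-∧ : ∀ x y → ind (x ∧ y) ≡ ind x * ind y
ind-∧ true y = sym (+-identityʳ (ind y))
ind-∧ false y = refl

ind-if : ∀ x v → (if x then v else 0) ≡ ind x * v
ind-if true v = sym (+-identityʳ v)
ind-if false v = refl

ind-select : ∀ lt eq → lt ≡ not eq → ∀ x y → ind lt * ind x + ind eq * ind y ≡ ind (if lt then x else y)
ind-select true false _ x y = trans (+-identityʳ _) (+-identityʳ _)
ind-select false true _ x y = +-identityʳ _

eqBool⇒≡ : ∀ {x y} → eqBool x y ≡ true → x ≡ y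
eqBool⇒≡ {true} {true} _ = refl
eqBool⇒≡ {false} {false} _ = refl

eqBool-refl : ∀ x → eqBool x x ≡ true
eqBool-refl true = refl
eqBool-refl false = refl

≡⇒eqBool : ∀ {x y} → x ≡ y → eqBool x y ≡ true
≡⇒eqBool {x} refl = eqBool-refl x

all≡true⇒ : ∀ {A : Set} (p : A → Bool) xs → all p xs ≡ true → All (λ x → p x ≡ true) xs
all≡true⇒ p [] _ = []
all≡true⇒ p (x ∷ xs) holds = proj₁ (∧-true {p x} holds) ∷ all≡true⇒ p xs (proj₂ (∧-true {p x} holds))

all≡true⇐ : ∀ {A : Set} (p : A → Bool) xs → All (λ x → p x ≡ true) xs → all p xs ≡ true
all≡true⇐ p [] _ = refl
all≡true⇐ p (x ∷ xs) (px ∷ pxs) = ∧-intro px (all≡true⇐ p xs pxs)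

-- Finite sums

sumOver-++ : ∀ {A : Set} (xs ys : List A) (h : A → ℕ) → sumOver (xs ++ ys) h ≡ sumOver xs h + sumOver ys h
sumOver-++ [] ys h = refl
sumOver-++ (x ∷ xs) ys h = trans (cong (h x +_) (sumOver-++ xs ys h)) (sym (+-assoc (h x) _ _))

sumOver-concatMap : ∀ {A B : Set} (g : A → List B) (xs : List A) (h : B → ℕ) →
  sumOver (concatMap g xs) h ≡ sumOver xs (λ x → sumOver (g x) h)
sumOver-concatMap g [] h = refl
sumOver-concatMap g (x ∷ xs) h =
  trans (sumOver-++ (g x) (concatMap g xs) h) (cong (sumOver (g x) h +_) (sumOver-concatMap g xs h))

sumOver-map : ∀ {A B : Set} (φ : A → B) (xs : List A) (h : B → ℕ) → sumOver (map φ xs) h ≡ sumOver xs (h ∘ φ)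
sumOver-map φ [] h = refl
sumOver-map φ (x ∷ xs) h = cong (h (φ x) +_) (sumOver-map φ xs h)

sumOver-cong : ∀ {A : Set} (xs : List A) {h g : A → ℕ} → (∀ x → h x ≡ g x) → sumOver xs h ≡ sumOver xs g
sumOver-cong [] eq = refl
sumOver-cong (x ∷ xs) eq = cong₂ _+_ (eq x) (sumOver-cong xs eq)

sumOver-congᴬ : ∀ {A : Set} {xs : List A} {h g : A → ℕ} → All (λ x → h x ≡ g x) xs → sumOver xs h ≡ sumOver xs g
sumOver-congᴬ [] = refl
sumOver-congᴬ (eq ∷ eqs) = cong₂ _+_ eq (sumOver-congᴬ eqs)

sumOver-zero : ∀ {A : Set} (xs : List A) → sumOver xs (λ _ → 0) ≡ 0
sumOver-zero [] = refl
sumOver-zero (x ∷ xs) = sumOver-zero xs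

sumOver-+ : ∀ {A : Set} (xs : List A) (h g : A → ℕ) → sumOver xs (λ x → h x + g x) ≡ sumOver xs h + sumOver xs g
sumOver-+ [] h g = refl
sumOver-+ (x ∷ xs) h g = trans (cong (h x + g x +_) (sumOver-+ xs h g)) (interchange (h x) (g x) _ _)
  where
  interchange : ∀ p q r s → p + q + (r + s) ≡ p + r + (q + s)
  interchange = solve-∀

sumOver-*ˡ : ∀ {A : Set} (xs : List A) (k : ℕ) (h : A → ℕ) → sumOver xs (λ x → k * h x) ≡ k * sumOver xs h
sumOver-*ˡ [] k h = sym (*-zeroʳ k)
sumOver-*ˡ (x ∷ xs) k h = trans (cong (k * h x +_) (sumOver-*ˡ xs k h)) (sym (*-distribˡ-+ k (h x) _))

sumOver-*ʳ : ∀ {A : Set} (xs : List A) (k : ℕ) (h : A → ℕ) → sumOver xs (λ x → h x * k) ≡ sumOver xs h * k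
sumOver-*ʳ [] k h = refl
sumOver-*ʳ (x ∷ xs) k h = trans (cong (h x * k +_) (sumOver-*ʳ xs k h)) (sym (*-distribʳ-+ k (h x) _))

sumOver-swap : ∀ {A B : Set} (xs : List A) (ys : List B) (h : A → B → ℕ) →
  sumOver xs (λ x → sumOver ys (h x)) ≡ sumOver ys (λ y → sumOver xs (λ x → h x y))
sumOver-swap [] ys h = sym (sumOver-zero ys)
sumOver-swap (x ∷ xs) ys h =
  trans (cong (sumOver ys (h x) +_) (sumOver-swap xs ys h)) (sym (sumOver-+ ys (h x) (λ y → sumOver xs (λ x′ → h x′ y))))

sumOver-filter : ∀ {A : Set} (p : A → Bool) (xs : List A) (h : A → ℕ) →
  sumOver (filterᵇ p xs) h ≡ sumOver xs (λ x → ind (p x) * h x)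
sumOver-filter p [] h = refl
sumOver-filter p (x ∷ xs) h with p x
... | true = cong₂ _+_ (sym (+-identityʳ (h x))) (sumOver-filter p xs h)
... | false = sumOver-filter p xs h

length-filter : ∀ {A : Set} (p : A → Bool) (xs : List A) → length (filterᵇ p xs) ≡ sumOver xs (ind ∘ p)
length-filter p [] = refl
length-filter p (x ∷ xs) with p x
... | true = cong suc (length-filter p xs)
... | false = length-filter p xs

sumOver-upTo-suc : ∀ n (g : ℕ → ℕ) → sumOver (upTo (suc n)) g ≡ g 0 + sumOver (upTo n) (g ∘ suc)
sumOver-upTo-suc n g = cong (λ xs → g 0 + sum xs)
  (trans (List.map-applyUpTo suc g n) (sym (List.map-upTo (g ∘ suc) n)))

sumOver-upTo-select : ∀ n k (g : ℕ → ℕ) → sumOver (upTo n) (λ j → ind (k ≡ᵇ j) * g j) ≡ ind (k <ᵇ n) * g k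
sumOver-upTo-select zero k g = refl
sumOver-upTo-select (suc n) zero g =
  trans (sumOver-upTo-suc n _) (trans (cong (g 0 + 0 +_) (sumOver-zero (upTo n))) (+-identityʳ _))
sumOver-upTo-select (suc n) (suc k) g =
  trans (sumOver-upTo-suc n (λ j → ind (suc k ≡ᵇ j) * g j)) (sumOver-upTo-select n k (g ∘ suc))

sumOver-upTo-select< : ∀ n k (g : ℕ → ℕ) → k < n → sumOver (upTo n) (λ j → ind (k ≡ᵇ j) * g j) ≡ g k
sumOver-upTo-select< n k g k<n =
  trans (sumOver-upTo-select n k g) (trans (cong (λ x → ind x * g k) (<⇒<ᵇ≡true k<n)) (+-identityʳ (g k)))

sumOver-upTo-select-bij : ∀ n (σ τ : ℕ → ℕ) i (g : ℕ → ℕ) →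
  (∀ x → x < n → τ (σ x) ≡ x) → σ (τ i) ≡ i → τ i < n →
  sumOver (upTo n) (λ x → ind (i ≡ᵇ σ x) * g x) ≡ g (τ i)
sumOver-upTo-select-bij n σ τ i g τσ στi τi<n =
  trans (sumOver-congᴬ (All.map (λ {x} x<n → cong (λ z → ind z * g x) (bool-ext
      (λ i≡σx → ≡⇒≡ᵇ≡true (trans (cong τ (≡ᵇ≡true⇒≡ i≡σx)) (τσ x x<n)))
      (λ τi≡x → ≡⇒≡ᵇ≡true (trans (sym στi) (cong σ (≡ᵇ≡true⇒≡ τi≡x))))))
    (all-upTo n)))
  (sumOver-upTo-select< n (τ i) g τi<n)

module _ {A B : Set} (xs : List A) (ys : List B) (P : A → Bool) (Q : B → Bool)
  (_≈ᴬ_ : A → A → Bool) (_≈ᴮ_ : B → B → Bool)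
  (≈ᴬ⇒≡ : ∀ {x y} → (x ≈ᴬ y) ≡ true → x ≡ y) (≈ᴬ-refl : ∀ x → (x ≈ᴬ x) ≡ true)
  (≈ᴮ⇒≡ : ∀ {x y} → (x ≈ᴮ y) ≡ true → x ≡ y) (≈ᴮ-refl : ∀ y → (y ≈ᴮ y) ≡ true)
  (once-in-xs : ∀ x → P x ≡ true → sumOver xs (λ x′ → ind (x′ ≈ᴬ x)) ≡ 1)
  (once-in-ys : ∀ y → Q y ≡ true → sumOver ys (λ y′ → ind (y′ ≈ᴮ y)) ≡ 1)
  (φ : A → B) (ψ : B → A)
  (φ-Q : ∀ x → P x ≡ true → Q (φ x) ≡ true) (ψ-P : ∀ y → Q y ≡ true → P (ψ y) ≡ true)
  (ψ∘φ : ∀ x → P x ≡ true → ψ (φ x) ≡ x) (φ∘ψ : ∀ y → Q y ≡ true → φ (ψ y) ≡ y) where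

  private
    count-as-double-sum-A : ∀ x → ind (P x) ≡ sumOver ys (λ y → ind (P x) * ind (y ≈ᴮ φ x))
    count-as-double-sum-A x with P x in Px
    ... | true = sym (trans (sumOver-*ˡ ys 1 _) (cong (1 *_) (once-in-ys (φ x) (φ-Q x Px))))
    ... | false = sym (sumOver-zero ys)

    count-as-double-sum-B : ∀ y → ind (Q y) ≡ sumOver xs (λ x → ind (Q y) * ind (x ≈ᴬ ψ y))
    count-as-double-sum-B y with Q y in Qy
    ... | true = sym (trans (sumOver-*ˡ xs 1 _) (cong (1 *_) (once-in-xs (ψ y) (ψ-P y Qy))))
    ... | false = sym (sumOver-zero xs)

    related : ∀ x y → (P x ∧ (y ≈ᴮ φ x)) ≡ (Q y ∧ (x ≈ᴬ ψ y))
    related x y = bool-ext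
      (λ h → let Px , y≡φx = ∧-true {P x} h in
        ∧-intro (subst (λ z → Q z ≡ true) (sym (≈ᴮ⇒≡ y≡φx)) (φ-Q x Px))
                (subst (λ z → (x ≈ᴬ z) ≡ true) (sym (trans (cong ψ (≈ᴮ⇒≡ y≡φx)) (ψ∘φ x Px))) (≈ᴬ-refl x)))
      (λ h → let Qy , x≡ψy = ∧-true {Q y} h in
        ∧-intro (subst (λ z → P z ≡ true) (sym (≈ᴬ⇒≡ x≡ψy)) (ψ-P y Qy))
                (subst (λ z → (y ≈ᴮ z) ≡ true) (sym (trans (cong φ (≈ᴬ⇒≡ x≡ψy)) (φ∘ψ y Qy))) (≈ᴮ-refl y)))

  count-by-bijection : sumOver xs (ind ∘ P) ≡ sumOver ys (ind ∘ Q)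
  count-by-bijection = begin
      sumOver xs (ind ∘ P)
    ≡⟨ sumOver-cong xs count-as-double-sum-A ⟩
      sumOver xs (λ x → sumOver ys (λ y → ind (P x) * ind (y ≈ᴮ φ x)))
    ≡⟨ sumOver-swap xs ys _ ⟩
      sumOver ys (λ y → sumOver xs (λ x → ind (P x) * ind (y ≈ᴮ φ x)))
    ≡⟨ sumOver-cong ys (λ y → sumOver-cong xs (λ x →
         trans (sym (ind-∧ (P x) _)) (trans (cong ind (related x y)) (ind-∧ (Q y) _)))) ⟩
      sumOver ys (λ y → sumOver xs (λ x → ind (Q y) * ind (x ≈ᴬ ψ y)))
    ≡⟨ sym (sumOver-cong ys count-as-double-sum-B) ⟩
      sumOver ys (ind ∘ Q)
    ∎

eqList : {A : Set} → (A → A → Bool) → List A → List A → Bool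
eqList _≈_ [] [] = true
eqList _≈_ (x ∷ xs) (y ∷ ys) = (x ≈ y) ∧ eqList _≈_ xs ys
eqList _≈_ _ _ = false

eqList⇒≡ : {A : Set} (_≈_ : A → A → Bool) → (∀ {x y} → (x ≈ y) ≡ true → x ≡ y) →
  ∀ {xs ys} → eqList _≈_ xs ys ≡ true → xs ≡ ys
eqList⇒≡ _≈_ ≈⇒≡ {[]} {[]} _ = refl
eqList⇒≡ _≈_ ≈⇒≡ {x ∷ xs} {y ∷ ys} eq =
  cong₂ _∷_ (≈⇒≡ (proj₁ (∧-true {x ≈ y} eq))) (eqList⇒≡ _≈_ ≈⇒≡ (proj₂ (∧-true {x ≈ y} eq)))

eqList-refl : {A : Set} (_≈_ : A → A → Bool) → (∀ x → (x ≈ x) ≡ true) → ∀ xs → eqList _≈_ xs xs ≡ true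
eqList-refl _≈_ ≈-refl [] = refl
eqList-refl _≈_ ≈-refl (x ∷ xs) = ∧-intro (≈-refl x) (eqList-refl _≈_ ≈-refl xs)

length-selections : ∀ r → All (λ s → length s ≡ r) (selections r)
length-selections zero = refl ∷ []
length-selections (suc r) = concat⁺ (map⁺ (All.map (λ len → cong suc len ∷ cong suc len ∷ []) (length-selections r)))

selections-once : ∀ r s → length s ≡ r → sumOver (selections r) (λ s′ → ind (eqList eqBool s′ s)) ≡ 1
selections-once zero [] _ = refl
selections-once (suc r) (x ∷ s) len =
  trans (sumOver-concatMap (λ s′ → (true ∷ s′) ∷ (false ∷ s′) ∷ []) (selections r) _)
  (trans (sumOver-cong (selections r) (head-matches x)) (selections-once r s (suc-injective len)))
  where
  head-matches : ∀ x s′ → ind (eqList eqBool (true ∷ s′) (x ∷ s)) + (ind (eqList eqBool (false ∷ s′) (x ∷ s)) + 0)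
                          ≡ ind (eqList eqBool s′ s)
  head-matches true s′ = +-identityʳ _
  head-matches false s′ = +-identityʳ _

lookupOr : {A : Set} → A → List A → ℕ → A
lookupOr z [] _ = z
lookupOr z (x ∷ xs) zero = x
lookupOr z (x ∷ xs) (suc k) = lookupOr z xs k

lookupOr-++ˡ : ∀ {A : Set} (z : A) (xs ys : List A) k → k < length xs → lookupOr z (xs ++ ys) k ≡ lookupOr z xs k
lookupOr-++ˡ z (x ∷ xs) ys zero _ = refl
lookupOr-++ˡ z (x ∷ xs) ys (suc k) (s≤s k<) = lookupOr-++ˡ z xs ys k k<

lookupOr-++ʳ : ∀ {A : Set} (z : A) (xs ys : List A) k → lookupOr z (xs ++ ys) (length xs + k) ≡ lookupOr z ys k
lookupOr-++ʳ z [] ys k = refl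
lookupOr-++ʳ z (x ∷ xs) ys k = lookupOr-++ʳ z xs ys k

lookupOr-applyUpTo : ∀ {A : Set} (z : A) (g : ℕ → A) r k → k < r → lookupOr z (applyUpTo g r) k ≡ g k
lookupOr-applyUpTo z g (suc r) zero _ = refl
lookupOr-applyUpTo z g (suc r) (suc k) (s≤s k<r) = lookupOr-applyUpTo z (g ∘ suc) r k k<r

lookupOr-map-upTo : ∀ {A : Set} (z : A) (g : ℕ → A) r k → k < r → lookupOr z (map g (upTo r)) k ≡ g k
lookupOr-map-upTo z g r k k<r = trans (cong (λ xs → lookupOr z xs k) (List.map-upTo g r)) (lookupOr-applyUpTo z g r k k<r)

lookupOr-drop : ∀ {A : Set} (z : A) (xs : List A) k x → lookupOr z (drop k xs) x ≡ lookupOr z xs (k + x)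
lookupOr-drop z xs zero x = refl
lookupOr-drop z [] (suc k) x = refl
lookupOr-drop z (y ∷ xs) (suc k) x = lookupOr-drop z xs k x

applyUpTo-cong : ∀ {A : Set} (g h : ℕ → A) r → (∀ k → k < r → g k ≡ h k) → applyUpTo g r ≡ applyUpTo h r
applyUpTo-cong g h zero eq = refl
applyUpTo-cong g h (suc r) eq =
  cong₂ _∷_ (eq 0 (s≤s z≤n)) (applyUpTo-cong (g ∘ suc) (h ∘ suc) r (λ k k<r → eq (suc k) (s≤s k<r)))

map-upTo-cong : ∀ {A : Set} (g h : ℕ → A) r → (∀ k → k < r → g k ≡ h k) → map g (upTo r) ≡ map h (upTo r)
map-upTo-cong g h r eq = trans (List.map-upTo g r) (trans (applyUpTo-cong g h r eq) (sym (List.map-upTo h r)))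

length-map-upTo : ∀ {A : Set} (g : ℕ → A) r → length (map g (upTo r)) ≡ r
length-map-upTo g r = trans (List.length-map g (upTo r)) (List.length-upTo r)

take-lookupOr : ∀ {A : Set} (z : A) (xs : List A) r → r ≤ length xs → map (lookupOr z xs) (upTo r) ≡ take r xs
take-lookupOr z xs zero _ = refl
take-lookupOr z (x ∷ xs) (suc r) (s≤s r≤) = cong (x ∷_)
  (trans (List.map-applyUpTo suc (lookupOr z (x ∷ xs)) r)
  (trans (sym (List.map-upTo (lookupOr z xs) r)) (take-lookupOr z xs r r≤)))

map-lookupOr-upTo : ∀ {A : Set} (z : A) (xs : List A) r → length xs ≡ r → map (lookupOr z xs) (upTo r) ≡ xs
map-lookupOr-upTo z xs r refl = trans (take-lookupOr z xs (length xs) ≤-refl) (List.take-all (length xs) xs ≤-refl)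

grid : {A : Set} → ℕ → ℕ → (ℕ → ℕ → A) → List A
grid r s g = concatMap (λ i → map (g i) (upTo s)) (upTo r)

grid-suc : ∀ {A : Set} r s (g : ℕ → ℕ → A) → grid (suc r) s g ≡ map (g 0) (upTo s) ++ grid r s (g ∘ suc)
grid-suc r s g = cong (λ xss → map (g 0) (upTo s) ++ concat xss)
  (trans (List.map-applyUpTo suc (λ i → map (g i) (upTo s)) r) (sym (List.map-upTo (λ i → map (g (suc i)) (upTo s)) r)))

grid-cong : ∀ {A : Set} r s (g h : ℕ → ℕ → A) → (∀ i j → i < r → j < s → g i j ≡ h i j) → grid r s g ≡ grid r s h
grid-cong r s g h eq =
  cong concat (map-upTo-cong _ _ r (λ i i<r → map-upTo-cong (g i) (h i) s (λ j j<s → eq i j i<r j<s)))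

length-grid : ∀ {A : Set} r s (g : ℕ → ℕ → A) → length (grid r s g) ≡ r * s
length-grid zero s g = refl
length-grid (suc r) s g = trans (cong length (grid-suc r s g))
  (trans (List.length-++ (map (g 0) (upTo s))) (cong₂ _+_ (length-map-upTo (g 0) s) (length-grid r s (g ∘ suc))))

lookupOr-grid : ∀ {A : Set} (z : A) r s (g : ℕ → ℕ → A) i j → i < r → j < s → lookupOr z (grid r s g) (i * s + j) ≡ g i j
lookupOr-grid z (suc r) s g zero j _ j<s =
  trans (cong (λ xs → lookupOr z xs j) (grid-suc r s g))
  (trans (lookupOr-++ˡ z (map (g 0) (upTo s)) _ j (subst (j <_) (sym (length-map-upTo (g 0) s)) j<s))
         (lookupOr-map-upTo z (g 0) s j j<s))
lookupOr-grid z (suc r) s g (suc i) j (s≤s i<r) j<s =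
  trans (cong (λ xs → lookupOr z xs (suc i * s + j)) (grid-suc r s g))
  (trans (cong (lookupOr z (map (g 0) (upTo s) ++ _))
           (trans (+-assoc s (i * s) j) (cong (_+ (i * s + j)) (sym (length-map-upTo (g 0) s)))))
  (trans (lookupOr-++ʳ z (map (g 0) (upTo s)) _ (i * s + j)) (lookupOr-grid z r s (g ∘ suc) i j i<r j<s)))

grid-lookupOr : ∀ {A : Set} (z : A) r s (xs : List A) → length xs ≡ r * s → grid r s (λ i j → lookupOr z xs (i * s + j)) ≡ xs
grid-lookupOr z zero s [] _ = refl
grid-lookupOr z (suc r) s xs len = begin
    grid (suc r) s (λ i j → lookupOr z xs (i * s + j))
  ≡⟨ grid-suc r s _ ⟩
    map (lookupOr z xs) (upTo s) ++ grid r s (λ i j → lookupOr z xs (s + i * s + j))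
  ≡⟨ cong₂ _++_ (take-lookupOr z xs s (subst (s ≤_) (sym len) (m≤m+n s (r * s))))
       (grid-cong r s _ _ (λ i j _ _ → trans (cong (lookupOr z xs) (+-assoc s (i * s) j)) (sym (lookupOr-drop z xs s (i * s + j))))) ⟩
    take s xs ++ grid r s (λ i j → lookupOr z (drop s xs) (i * s + j))
  ≡⟨ cong (take s xs ++_) (grid-lookupOr z r s (drop s xs)
       (trans (List.length-drop s xs) (trans (cong (_∸ s) len) (m+n∸m≡n s (r * s))))) ⟩
    take s xs ++ drop s xs
  ≡⟨ List.take++drop≡id s xs ⟩
    xs
  ∎

zipWith-++ : ∀ {A B C : Set} (g : A → B → C) (xs xs′ : List A) (ys ys′ : List B) → length xs ≡ length ys →
  zipWith g (xs ++ xs′) (ys ++ ys′) ≡ zipWith g xs ys ++ zipWith g xs′ ys′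
zipWith-++ g [] xs′ [] ys′ _ = refl
zipWith-++ g (x ∷ xs) xs′ (y ∷ ys) ys′ len = cong (g x y ∷_) (zipWith-++ g xs xs′ ys ys′ (suc-injective len))

zipWith-map-upTo : ∀ {A B C : Set} (g : A → B → C) (u : ℕ → A) (v : ℕ → B) r →
  zipWith g (map u (upTo r)) (map v (upTo r)) ≡ map (λ j → g (u j) (v j)) (upTo r)
zipWith-map-upTo g u v r =
  trans (cong₂ (zipWith g) (List.map-upTo u r) (List.map-upTo v r)) (trans (go u v r) (sym (List.map-upTo _ r)))
  where
  go : (u : ℕ → _) (v : ℕ → _) (r : ℕ) → zipWith g (applyUpTo u r) (applyUpTo v r) ≡ applyUpTo (λ j → g (u j) (v j)) r
  go u v zero = refl
  go u v (suc r) = cong (g (u 0) (v 0) ∷_) (go (u ∘ suc) (v ∘ suc) r)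

zipWith-grid : ∀ {A B C : Set} (g : A → B → C) r s (u : ℕ → ℕ → A) (v : ℕ → ℕ → B) →
  zipWith g (grid r s u) (grid r s v) ≡ grid r s (λ i j → g (u i j) (v i j))
zipWith-grid g zero s u v = refl
zipWith-grid g (suc r) s u v = begin
    zipWith g (grid (suc r) s u) (grid (suc r) s v)
  ≡⟨ cong₂ (zipWith g) (grid-suc r s u) (grid-suc r s v) ⟩
    zipWith g (map (u 0) (upTo s) ++ grid r s (u ∘ suc)) (map (v 0) (upTo s) ++ grid r s (v ∘ suc))
  ≡⟨ zipWith-++ g (map (u 0) (upTo s)) _ (map (v 0) (upTo s)) _ (trans (length-map-upTo (u 0) s) (sym (length-map-upTo (v 0) s))) ⟩
    zipWith g (map (u 0) (upTo s)) (map (v 0) (upTo s)) ++ zipWith g (grid r s (u ∘ suc)) (grid r s (v ∘ suc))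
  ≡⟨ cong₂ _++_ (zipWith-map-upTo g (u 0) (v 0) s) (zipWith-grid g r s (u ∘ suc) (v ∘ suc)) ⟩
    map (λ j → g (u 0 j) (v 0 j)) (upTo s) ++ grid r s (λ i j → g (u (suc i) j) (v (suc i) j))
  ≡⟨ sym (grid-suc r s _) ⟩
    grid (suc r) s (λ i j → g (u i j) (v i j))
  ∎

sum-grid : ∀ r s (g : ℕ → ℕ → ℕ) → sum (grid r s g) ≡ sumOver (upTo r) (λ i → sumOver (upTo s) (g i))
sum-grid zero s g = refl
sum-grid (suc r) s g =
  trans (cong sum (grid-suc r s g))
  (trans (sum-++ (map (g 0) (upTo s)) _)
  (trans (cong (sumOver (upTo s) (g 0) +_) (sum-grid r s (g ∘ suc)))
  (sym (sumOver-upTo-suc r (λ i → sumOver (upTo s) (g i))))))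

All-grid⁺ : ∀ {A : Set} {P : A → Set} r s (g : ℕ → ℕ → A) → (∀ i j → i < r → j < s → P (g i j)) → All P (grid r s g)
All-grid⁺ r s g h = concat⁺ (map⁺ (All.map (λ i<r → map⁺ (All.map (h _ _ i<r) (all-upTo s))) (all-upTo r)))

All-grid⁻ : ∀ {A : Set} {P : A → Set} r s (g : ℕ → ℕ → A) → All P (grid r s g) → ∀ i j → i < r → j < s → P (g i j)
All-grid⁻ r s g all i j i<r j<s = applyUpTo⁻ id s (map⁻ (applyUpTo⁻ id r (map⁻ (concat⁻ all)) i<r)) j<s

All-filterᵇ : ∀ {A : Set} (p : A → Bool) xs → All (λ x → p x ≡ true) (filterᵇ p xs)
All-filterᵇ p [] = []
All-filterᵇ p (x ∷ xs) with p x in px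
... | true = px ∷ All-filterᵇ p xs
... | false = All-filterᵇ p xs

All-lookupOr⁻ : ∀ {A : Set} {P : A → Set} (z : A) xs → All P xs → ∀ j → j < length xs → P (lookupOr z xs j)
All-lookupOr⁻ z (x ∷ xs) (px ∷ pxs) zero _ = px
All-lookupOr⁻ z (x ∷ xs) (px ∷ pxs) (suc j) (s≤s j<) = All-lookupOr⁻ z xs pxs j j<

All-lookupOr⁺ : ∀ {A : Set} {P : A → Set} (z : A) xs → (∀ j → j < length xs → P (lookupOr z xs j)) → All P xs
All-lookupOr⁺ z [] _ = []
All-lookupOr⁺ z (x ∷ xs) h = h 0 (s≤s z≤n) ∷ All-lookupOr⁺ z xs (λ j j< → h (suc j) (s≤s j<))

-- Words

eqL⇒≡ : ∀ {x y} → eqL x y ≡ true → x ≡ y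
eqL⇒≡ {a} {a} _ = refl
eqL⇒≡ {b} {b} _ = refl
eqL⇒≡ {c} {c} _ = refl
eqL⇒≡ {d} {d} _ = refl
eqL⇒≡ {e} {e} _ = refl
eqL⇒≡ {f} {f} _ = refl

eqL-refl : ∀ x → eqL x x ≡ true
eqL-refl a = refl
eqL-refl b = refl
eqL-refl c = refl
eqL-refl d = refl
eqL-refl e = refl
eqL-refl f = refl

infixl 30 _‼_

_‼_ : ∀ {m} → Word m → ℕ → Letter
[] ‼ _ = b
(x ∷ w) ‼ zero = x
(x ∷ w) ‼ suc i = w ‼ i

tabulateW : (m : ℕ) → (ℕ → Letter) → Word m
tabulateW zero g = []
tabulateW (suc m) g = g 0 ∷ tabulateW m (g ∘ suc)

‼-tabulateW : ∀ m (g : ℕ → Letter) i → i < m → tabulateW m g ‼ i ≡ g i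
‼-tabulateW (suc m) g zero _ = refl
‼-tabulateW (suc m) g (suc i) (s≤s i<m) = ‼-tabulateW m (g ∘ suc) i i<m

‼-ext : ∀ {m} (u w : Word m) → (∀ i → i < m → u ‼ i ≡ w ‼ i) → u ≡ w
‼-ext [] [] _ = refl
‼-ext (x ∷ u) (y ∷ w) eq = cong₂ _∷_ (eq 0 (s≤s z≤n)) (‼-ext u w (λ i i<m → eq (suc i) (s≤s i<m)))

tabulateW-‼ : ∀ {m} (g : ℕ → Letter) (w : Word m) → (∀ i → i < m → g i ≡ w ‼ i) → tabulateW m g ≡ w
tabulateW-‼ {m} g w eq = ‼-ext _ w (λ i i<m → trans (‼-tabulateW m g i i<m) (eq i i<m))

vAll⇒ : ∀ {m} (r : Letter → Letter → Bool) (u w : Word m) → vAll r u w ≡ true → ∀ i → i < m → r (u ‼ i) (w ‼ i) ≡ true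
vAll⇒ r (x ∷ u) (y ∷ w) holds zero _ = proj₁ (∧-true {r x y} holds)
vAll⇒ r (x ∷ u) (y ∷ w) holds (suc i) (s≤s i<m) = vAll⇒ r u w (proj₂ (∧-true {r x y} holds)) i i<m

vAll⇐ : ∀ {m} (r : Letter → Letter → Bool) (u w : Word m) → (∀ i → i < m → r (u ‼ i) (w ‼ i) ≡ true) → vAll r u w ≡ true
vAll⇐ r [] [] _ = refl
vAll⇐ r (x ∷ u) (y ∷ w) holds = ∧-intro (holds 0 (s≤s z≤n)) (vAll⇐ r u w (λ i i<m → holds (suc i) (s≤s i<m)))

eqW⇒≡ : ∀ {m} {u w : Word m} → eqW u w ≡ true → u ≡ w
eqW⇒≡ {u = u} {w} eq = ‼-ext u w (λ i i<m → eqL⇒≡ (vAll⇒ eqL u w eq i i<m))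

eqW-refl : ∀ {m} (u : Word m) → eqW u u ≡ true
eqW-refl u = vAll⇐ eqL u u (λ i _ → eqL-refl (u ‼ i))

≡⇒eqW : ∀ {m} {u w : Word m} → u ≡ w → eqW u w ≡ true
≡⇒eqW {u = u} refl = eqW-refl u

eqW-sym : ∀ {m} (u w : Word m) → eqW u w ≡ eqW w u
eqW-sym u w = bool-ext (λ eq → ≡⇒eqW (sym (eqW⇒≡ {u = u} eq))) (λ eq → ≡⇒eqW (sym (eqW⇒≡ {u = w} eq)))

lrArcs⇒ : ∀ {m} (u w : Word m) → vAll lrArc u w ≡ true → ∀ i → i < m → hasRight (u ‼ i) ≡ hasLeft (w ‼ i)
lrArcs⇒ u w arcs i i<m = eqBool⇒≡ (vAll⇒ lrArc u w arcs i i<m)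

lrArcs⇐ : ∀ {m} (u w : Word m) → (∀ i → i < m → hasRight (u ‼ i) ≡ hasLeft (w ‼ i)) → vAll lrArc u w ≡ true
lrArcs⇐ u w match = vAll⇐ lrArc u w (λ i i<m → ≡⇒eqBool (match i i<m))

next : ℕ → ℕ → ℕ
next m i = modN (suc i) m

prev : ℕ → ℕ → ℕ
prev m zero = m ∸ 1
prev m (suc i) = i

prevIter : ℕ → ℕ → ℕ → ℕ
prevIter m zero i = i
prevIter m (suc p) i = prev m (prevIter m p i)

module _ {k : ℕ} where
  private
    m = suc k

  next<m : ∀ i → next m i < m
  next<m i = m%n<n (suc i) m

  prev<m : ∀ i → i < m → prev m i < m
  prev<m zero _ = n<1+n k
  prev<m (suc i) i<m = <-trans (n<1+n i) i<m

  prevIter<m : ∀ p i → i < m → prevIter m p i < m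
  prevIter<m zero i i<m = i<m
  prevIter<m (suc p) i i<m = prev<m (prevIter m p i) (prevIter<m p i i<m)

  prev-next : ∀ i → i < m → prev m (next m i) ≡ i
  prev-next i i<m with m≤n⇒m<n∨m≡n i<m
  ... | inj₁ 1+i<m = cong (prev m) (m<n⇒m%n≡m 1+i<m)
  ... | inj₂ 1+i≡m = trans (cong (prev m) (trans (cong (_% m) 1+i≡m) (n%n≡0 m))) (suc-injective (sym 1+i≡m))

  next-prev : ∀ i → i < m → next m (prev m i) ≡ i
  next-prev zero _ = n%n≡0 m
  next-prev (suc i) i<m = m<n⇒m%n≡m i<m

‼-∷ʳ< : ∀ {m} (xs : Word m) x i → i < m → (xs Vec.∷ʳ x) ‼ i ≡ xs ‼ i
‼-∷ʳ< (y ∷ xs) x zero _ = refl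
‼-∷ʳ< (y ∷ xs) x (suc i) (s≤s i<m) = ‼-∷ʳ< xs x i i<m

‼-∷ʳ-last : ∀ {m} (xs : Word m) x → (xs Vec.∷ʳ x) ‼ m ≡ x
‼-∷ʳ-last [] x = refl
‼-∷ʳ-last (y ∷ xs) x = ‼-∷ʳ-last xs x

‼-rho : ∀ {k} (w : Word (suc k)) i → i < suc k → rho w ‼ i ≡ w ‼ next (suc k) i
‼-rho {k} (x ∷ xs) i i<m with m≤n⇒m<n∨m≡n i<m
... | inj₁ (s≤s 1+i<m) = trans (‼-∷ʳ< xs x i 1+i<m) (cong ((x ∷ xs) ‼_) (sym (m<n⇒m%n≡m (s≤s 1+i<m))))
... | inj₂ 1+i≡m = trans (cong ((xs Vec.∷ʳ x) ‼_) (suc-injective 1+i≡m))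
  (trans (‼-∷ʳ-last xs x) (cong ((x ∷ xs) ‼_) (sym (trans (cong (_% suc k) 1+i≡m) (n%n≡0 (suc k))))))

rhoInv : ∀ {m} → Word m → Word m
rhoInv {m} w = tabulateW m (λ i → w ‼ prev m i)

rhoInvP : ∀ {m} → ℕ → Word m → Word m
rhoInvP zero w = w
rhoInvP (suc p) w = rhoInvP p (rhoInv w)

‼-rhoInvP : ∀ {k} p (w : Word (suc k)) i → i < suc k → rhoInvP p w ‼ i ≡ w ‼ prevIter (suc k) p i
‼-rhoInvP zero w i i<m = refl
‼-rhoInvP {k} (suc p) w i i<m = trans (‼-rhoInvP p (rhoInv w) i i<m)
  (‼-tabulateW (suc k) (λ j → w ‼ prev (suc k) j) (prevIter (suc k) p i) (prevIter<m p i i<m))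

module _ {k : ℕ} where
  private
    m = suc k

  rho-rhoInv : ∀ (w : Word m) → rho (rhoInv w) ≡ w
  rho-rhoInv w = ‼-ext _ _ (λ i i<m → trans (‼-rho (rhoInv w) i i<m)
    (trans (‼-tabulateW m (λ j → w ‼ prev m j) (next m i) (next<m i)) (cong (w ‼_) (prev-next i i<m))))

  rhoInv-rho : ∀ (w : Word m) → rhoInv (rho w) ≡ w
  rhoInv-rho w = tabulateW-‼ _ w (λ i i<m → trans (‼-rho w (prev m i) (prev<m i i<m)) (cong (w ‼_) (next-prev i i<m)))

  rhoP≡⇒ : ∀ p (x w : Word m) → x ≡ rhoP p w → w ≡ rhoInvP p x
  rhoP≡⇒ zero x w eq = sym eq
  rhoP≡⇒ (suc p) x w eq = rhoP≡⇒ p (rhoInv x) w (trans (cong rhoInv eq) (rhoInv-rho _))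

  rhoP≡⇐ : ∀ p (x w : Word m) → w ≡ rhoInvP p x → x ≡ rhoP p w
  rhoP≡⇐ zero x w eq = sym eq
  rhoP≡⇐ (suc p) x w eq = trans (sym (rho-rhoInv x)) (cong rho (rhoP≡⇐ p (rhoInv x) w eq))

  eqW-rhoP : ∀ p (x w : Word m) → eqW x (rhoP p w) ≡ eqW w (rhoInvP p x)
  eqW-rhoP p x w = bool-ext (λ eq → ≡⇒eqW (rhoP≡⇒ p x w (eqW⇒≡ eq))) (λ eq → ≡⇒eqW (rhoP≡⇐ p x w (eqW⇒≡ eq)))

isVertex⇒ : ∀ {k} (w : Word (suc k)) → isVertex w ≡ true → ∀ i → i < suc k → hasDown (w ‼ i) ≡ hasUp (w ‼ next (suc k) i)
isVertex⇒ w vw i i<m = trans (eqBool⇒≡ (vAll⇒ udArc w (rho w) vw i i<m)) (cong hasUp (‼-rho w i i<m))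

isVertex⇐ : ∀ {k} (w : Word (suc k)) → (∀ i → i < suc k → hasDown (w ‼ i) ≡ hasUp (w ‼ next (suc k) i)) → isVertex w ≡ true
isVertex⇐ w match = vAll⇐ udArc w (rho w) (λ i i<m → ≡⇒eqBool (trans (match i i<m) (sym (cong hasUp (‼-rho w i i<m)))))

abc bdf : List Letter
abc = a ∷ b ∷ c ∷ []
bdf = b ∷ d ∷ f ∷ []

inLetters-abc : ∀ x → inLetters abc x ≡ not (hasLeft x)
inLetters-abc a = refl
inLetters-abc b = refl
inLetters-abc c = refl
inLetters-abc d = refl
inLetters-abc e = refl
inLetters-abc f = refl

inLetters-bdf : ∀ x → inLetters bdf x ≡ not (hasRight x)
inLetters-bdf a = refl
inLetters-bdf b = refl
inLetters-bdf c = refl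
inLetters-bdf d = refl
inLetters-bdf e = refl
inLetters-bdf f = refl

allIn⇒ : ∀ {m} S (w : Word m) → allIn S w ≡ true → ∀ i → i < m → inLetters S (w ‼ i) ≡ true
allIn⇒ S (x ∷ w) all zero _ = proj₁ (∧-true {inLetters S x} all)
allIn⇒ S (x ∷ w) all (suc i) (s≤s i<m) = allIn⇒ S w (proj₂ (∧-true {inLetters S x} all)) i i<m

allIn⇐ : ∀ {m} S (w : Word m) → (∀ i → i < m → inLetters S (w ‼ i) ≡ true) → allIn S w ≡ true
allIn⇐ S [] _ = refl
allIn⇐ S (x ∷ w) all = ∧-intro (all 0 (s≤s z≤n)) (allIn⇐ S w (λ i i<m → all (suc i) (s≤s i<m)))

not≡true : ∀ {x} → not x ≡ true → x ≡ false
not≡true {false} _ = refl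

allIn-abc⇒ : ∀ {m} (w : Word m) → allIn abc w ≡ true → ∀ i → i < m → hasLeft (w ‼ i) ≡ false
allIn-abc⇒ w all i i<m = not≡true (trans (sym (inLetters-abc (w ‼ i))) (allIn⇒ abc w all i i<m))

allIn-abc⇐ : ∀ {m} (w : Word m) → (∀ i → i < m → hasLeft (w ‼ i) ≡ false) → allIn abc w ≡ true
allIn-abc⇐ w noLeft = allIn⇐ abc w (λ i i<m → trans (inLetters-abc (w ‼ i)) (cong not (noLeft i i<m)))

allIn-bdf⇒ : ∀ {m} (w : Word m) → allIn bdf w ≡ true → ∀ i → i < m → hasRight (w ‼ i) ≡ false
allIn-bdf⇒ w all i i<m = not≡true (trans (sym (inLetters-bdf (w ‼ i))) (allIn⇒ bdf w all i i<m))

allIn-bdf⇐ : ∀ {m} (w : Word m) → (∀ i → i < m → hasRight (w ‼ i) ≡ false) → allIn bdf w ≡ true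
allIn-bdf⇐ w noRight = allIn⇐ bdf w (λ i i<m → trans (inLetters-bdf (w ‼ i)) (cong not (noRight i i<m)))

allIn-replicate-b : ∀ r S → inLetters S b ≡ true → allIn S (replicate r b) ≡ true
allIn-replicate-b zero S _ = refl
allIn-replicate-b (suc r) S b∈S = ∧-intro b∈S (allIn-replicate-b r S b∈S)

arc-into-noLeft : ∀ {m} (u v : Word m) → allIn abc u ≡ true → vAll lrArc v u ≡ allIn bdf v
arc-into-noLeft u v u-abc = bool-ext
  (λ arc → allIn-bdf⇐ v (λ i i<m → trans (lrArcs⇒ v u arc i i<m) (allIn-abc⇒ u u-abc i i<m)))
  (λ v-bdf → lrArcs⇐ v u (λ i i<m → trans (allIn-bdf⇒ v v-bdf i i<m) (sym (allIn-abc⇒ u u-abc i i<m))))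

arc-from-noRight : ∀ {m} (u w : Word m) → allIn bdf u ≡ true → vAll lrArc u w ≡ allIn abc w
arc-from-noRight u w u-bdf = bool-ext
  (λ arc → allIn-abc⇐ w (λ i i<m → trans (sym (lrArcs⇒ u w arc i i<m)) (allIn-bdf⇒ u u-bdf i i<m)))
  (λ w-abc → lrArcs⇐ u w (λ i i<m → trans (allIn-bdf⇒ u u-bdf i i<m) (sym (allIn-abc⇒ w w-abc i i<m))))

‼-map : ∀ {r} (g : Letter → Letter) (w : Word r) i → i < r → Vec.map g w ‼ i ≡ g (w ‼ i)
‼-map g (x ∷ w) zero _ = refl
‼-map g (x ∷ w) (suc i) (s≤s i<r) = ‼-map g w i i<r

‼-reverse : ∀ {r} (w : Word (suc r)) i → i < suc r → reverse w ‼ i ≡ w ‼ (r ∸ i)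
‼-reverse {zero} (x ∷ []) zero _ = refl
‼-reverse {zero} (x ∷ []) (suc i) (s≤s ())
‼-reverse {suc r} (x ∷ w) i i≤r+1 with m≤n⇒m<n∨m≡n i≤r+1
... | inj₁ (s≤s i≤r) = trans (cong (_‼ i) (Vec.reverse-∷ x w)) (trans (‼-∷ʳ< (reverse w) x i i≤r)
      (trans (‼-reverse w i i≤r) (cong ((x ∷ w) ‼_) (sym (+-∸-assoc 1 (≤-pred i≤r))))))
... | inj₂ 1+i≡r+2 = trans (cong (_‼ i) (Vec.reverse-∷ x w)) (trans (cong ((reverse w Vec.∷ʳ x) ‼_) (suc-injective 1+i≡r+2))
      (trans (‼-∷ʳ-last (reverse w) x) (cong ((x ∷ w) ‼_) (sym (trans (cong (suc r ∸_) (suc-injective 1+i≡r+2)) (n∸n≡0 (suc r)))))))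

hasUp-bar : ∀ x → hasUp (bar x) ≡ hasDown x
hasUp-bar a = refl
hasUp-bar b = refl
hasUp-bar c = refl
hasUp-bar d = refl
hasUp-bar e = refl
hasUp-bar f = refl

hasDown-bar : ∀ x → hasDown (bar x) ≡ hasUp x
hasDown-bar a = refl
hasDown-bar b = refl
hasDown-bar c = refl
hasDown-bar d = refl
hasDown-bar e = refl
hasDown-bar f = refl

hasLeft-bar : ∀ x → hasLeft (bar x) ≡ hasLeft x
hasLeft-bar a = refl
hasLeft-bar b = refl
hasLeft-bar c = refl
hasLeft-bar d = refl
hasLeft-bar e = refl
hasLeft-bar f = refl

module _ {k : ℕ} where
  private
    m = suc k

  rho-vertex : ∀ (w : Word m) → isVertex w ≡ true → isVertex (rho w) ≡ true
  rho-vertex w vw = isVertex⇐ (rho w) (λ i i<m → trans (cong hasDown (‼-rho w i i<m))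
    (trans (isVertex⇒ w vw (next m i) (next<m i)) (cong hasUp (sym (‼-rho w (next m i) (next<m i))))))

  rhoP-vertex : ∀ p (w : Word m) → isVertex w ≡ true → isVertex (rhoP p w) ≡ true
  rhoP-vertex zero w vw = vw
  rhoP-vertex (suc p) w vw = rho-vertex (rhoP p w) (rhoP-vertex p w vw)

  rhoInv-vertex : ∀ (w : Word m) → isVertex w ≡ true → isVertex (rhoInv w) ≡ true
  rhoInv-vertex w vw = isVertex⇐ (rhoInv w) (λ i i<m →
    trans (cong hasDown (‼-rhoInv i i<m)) (trans (isVertex⇒ w vw (prev m i) (prev<m i i<m))
    (trans (cong (λ j → hasUp (w ‼ j)) (trans (next-prev i i<m) (sym (prev-next i i<m))))
    (cong hasUp (sym (‼-rhoInv (next m i) (next<m i)))))))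
    where
    ‼-rhoInv : ∀ i → i < m → rhoInv w ‼ i ≡ w ‼ prev m i
    ‼-rhoInv = ‼-tabulateW m (λ j → w ‼ prev m j)

  rhoInvP-vertex : ∀ p (w : Word m) → isVertex w ≡ true → isVertex (rhoInvP p w) ≡ true
  rhoInvP-vertex zero w vw = vw
  rhoInvP-vertex (suc p) w vw = rhoInvP-vertex p (rhoInv w) (rhoInv-vertex w vw)

  bm-vertex : isVertex (bm m) ≡ true
  bm-vertex = isVertex⇐ (bm m) (λ i i<m → trans (cong hasDown (‼-replicate m i i<m)) (cong hasUp (sym (‼-replicate m (next m i) (next<m i)))))
    where
    ‼-replicate : ∀ r i → i < r → replicate r b ‼ i ≡ b
    ‼-replicate (suc r) zero _ = refl
    ‼-replicate (suc r) (suc i) (s≤s i<r) = ‼-replicate r i i<r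

  ‼-conv : ∀ (x : Word m) j → j < m → conv x ‼ j ≡ bar (x ‼ (k ∸ j))
  ‼-conv x j j<m = trans (‼-reverse (Vec.map bar x) j j<m) (‼-map bar x (k ∸ j) (s≤s (m∸n≤m k j)))

  ∸-next : ∀ j → j < m → k ∸ next m j ≡ prev m (k ∸ j)
  ∸-next j j<m with m≤n⇒m<n∨m≡n j<m
  ... | inj₁ (s≤s j<k) = trans (cong (k ∸_) (m<n⇒m%n≡m (s≤s j<k))) (cong (prev m) (sym (+-∸-assoc 1 j<k)))
  ... | inj₂ 1+j≡m = trans (cong (k ∸_) (trans (cong (_% m) 1+j≡m) (n%n≡0 m)))
    (cong (prev m) (sym (trans (cong (k ∸_) (suc-injective 1+j≡m)) (n∸n≡0 k))))

  conv-vertex : ∀ (x : Word m) → isVertex x ≡ true → isVertex (conv x) ≡ true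
  conv-vertex x vx = isVertex⇐ (conv x) (λ j j<m → begin
      hasDown (conv x ‼ j)                    ≡⟨ cong hasDown (‼-conv x j j<m) ⟩
      hasDown (bar (x ‼ (k ∸ j)))             ≡⟨ hasDown-bar _ ⟩
      hasUp (x ‼ (k ∸ j))                     ≡⟨ cong (λ i → hasUp (x ‼ i)) (sym (next-prev (k ∸ j) (k∸j<m j))) ⟩
      hasUp (x ‼ next m (prev m (k ∸ j)))     ≡⟨ sym (isVertex⇒ x vx (prev m (k ∸ j)) (prev<m (k ∸ j) (k∸j<m j))) ⟩
      hasDown (x ‼ prev m (k ∸ j))            ≡⟨ cong (λ i → hasDown (x ‼ i)) (sym (∸-next j j<m)) ⟩
      hasDown (x ‼ (k ∸ next m j))            ≡⟨ sym (hasUp-bar _) ⟩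
      hasUp (bar (x ‼ (k ∸ next m j)))        ≡⟨ cong hasUp (sym (‼-conv x (next m j) (next<m j))) ⟩
      hasUp (conv x ‼ next m j)               ∎)
    where
    k∸j<m : ∀ j → k ∸ j < m
    k∸j<m j = s≤s (m∸n≤m k j)

letterWith : (up down left right : Bool) → Letter
letterWith true true false false = b
letterWith true false true false = f
letterWith true false false true = c
letterWith false true true false = d
letterWith false true false true = a
letterWith false false true true = e
letterWith _ _ _ _ = a

record HasEnds (x : Letter) (up down left right : Bool) : Set where
  field
    up≡ : hasUp x ≡ up
    down≡ : hasDown x ≡ down
    left≡ : hasLeft x ≡ left
    right≡ : hasRight x ≡ right

letter-degree : ∀ x → (ind (hasDown x) + ind (hasUp x)) + (ind (hasLeft x) + ind (hasRight x)) ≡ 2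
letter-degree a = refl
letter-degree b = refl
letter-degree c = refl
letter-degree d = refl
letter-degree e = refl
letter-degree f = refl

hasEnds-letterWith : ∀ up down left right → (ind down + ind up) + (ind left + ind right) ≡ 2 →
  HasEnds (letterWith up down left right) up down left right
hasEnds-letterWith true true true true ()
hasEnds-letterWith true true true false ()
hasEnds-letterWith true true false true ()
hasEnds-letterWith true true false false _ = record { up≡ = refl ; down≡ = refl ; left≡ = refl ; right≡ = refl }
hasEnds-letterWith true false true true ()
hasEnds-letterWith true false true false _ = record { up≡ = refl ; down≡ = refl ; left≡ = refl ; right≡ = refl }
hasEnds-letterWith true false false true _ = record { up≡ = refl ; down≡ = refl ; left≡ = refl ; right≡ = refl }
hasEnds-letterWith true false false false ()
hasEnds-letterWith false true true true ()
hasEnds-letterWith false true true false _ = record { up≡ = refl ; down≡ = refl ; left≡ = refl ; right≡ = refl }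
hasEnds-letterWith false true false true _ = record { up≡ = refl ; down≡ = refl ; left≡ = refl ; right≡ = refl }
hasEnds-letterWith false true false false ()
hasEnds-letterWith false false true true _ = record { up≡ = refl ; down≡ = refl ; left≡ = refl ; right≡ = refl }
hasEnds-letterWith false false true false ()
hasEnds-letterWith false false false true ()
hasEnds-letterWith false false false false ()

letterWith-ends : ∀ x → letterWith (hasUp x) (hasDown x) (hasLeft x) (hasRight x) ≡ x
letterWith-ends a = refl
letterWith-ends b = refl
letterWith-ends c = refl
letterWith-ends d = refl
letterWith-ends e = refl
letterWith-ends f = refl

-- Closing edges join (σ i, n-1) to (i, 0); a column sequence v₁ ⋯ v_n closes up exactly when
-- v_n has an arc to glue v₁.
record Twist (k : ℕ) : Set where
  field
    σ τ : ℕ → ℕ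
    σ<m : ∀ i → i < suc k → σ i < suc k
    τ<m : ∀ i → i < suc k → τ i < suc k
    τ∘σ : ∀ i → i < suc k → τ (σ i) ≡ i
    σ∘τ : ∀ i → i < suc k → σ (τ i) ≡ i
    glue : Word (suc k) → Word (suc k)
    hasLeft-glue : ∀ x i → i < suc k → hasLeft (glue x ‼ i) ≡ hasLeft (x ‼ τ i)
    glue-vertex : ∀ x → isVertex x ≡ true → isVertex (glue x) ≡ true

identityTwist : ∀ {k} → Twist k
identityTwist = record
  { σ = id ; τ = id ; σ<m = λ _ i<m → i<m ; τ<m = λ _ i<m → i<m
  ; τ∘σ = λ _ _ → refl ; σ∘τ = λ _ _ → refl ; glue = id ; hasLeft-glue = λ _ _ _ → refl ; glue-vertex = λ _ vx → vx }

module _ {k : ℕ} where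
  private
    m = suc k

  shift : ℕ → ℕ → ℕ
  shift p i = modN (i + p) m

  shift-suc : ∀ p i → shift (suc p) i ≡ shift p (next m i)
  shift-suc p i = trans (cong (_% m) (+-suc i p)) (sym (%-distribˡ-%ˡ (suc i) p))
    where
    %-distribˡ-%ˡ : ∀ x y → (x % m + y) % m ≡ (x + y) % m
    %-distribˡ-%ˡ x y = trans (%-distribˡ-+ (x % m) y m)
      (trans (cong (λ z → (z + y % m) % m) (m%n%n≡m%n x m)) (sym (%-distribˡ-+ x y m)))

  prevIter-shift : ∀ p i → i < m → prevIter m p (shift p i) ≡ i
  prevIter-shift zero i i<m = trans (cong (_% m) (+-identityʳ i)) (m<n⇒m%n≡m i<m)
  prevIter-shift (suc p) i i<m = trans (cong (λ j → prev m (prevIter m p j)) (shift-suc p i))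
    (trans (cong (prev m) (prevIter-shift p (next m i) (next<m i))) (prev-next i i<m))

  shift-prevIter : ∀ p i → i < m → shift p (prevIter m p i) ≡ i
  shift-prevIter zero i i<m = trans (cong (_% m) (+-identityʳ i)) (m<n⇒m%n≡m i<m)
  shift-prevIter (suc p) i i<m = trans (shift-suc p (prevIter m (suc p) i))
    (trans (cong (shift p) (next-prev (prevIter m p i) (prevIter<m p i i<m))) (shift-prevIter p i i<m))

  torusTwist : ℕ → Twist k
  torusTwist p = record
    { σ = shift p ; τ = prevIter m p
    ; σ<m = λ i _ → m%n<n (i + p) m ; τ<m = prevIter<m p
    ; τ∘σ = prevIter-shift p ; σ∘τ = shift-prevIter p
    ; glue = rhoInvP p ; hasLeft-glue = λ x i i<m → cong hasLeft (‼-rhoInvP p x i i<m)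
    ; glue-vertex = rhoInvP-vertex p }

  flip : ℕ → ℕ → ℕ
  flip p i = modN (m + p ∸ suc i) m

  flip≡shift : ∀ p i → i < m → flip p i ≡ shift p (k ∸ i)
  flip≡shift p i (s≤s i≤k) = cong (_% m) (+-∸-comm p i≤k)

  unflip : ℕ → ℕ → ℕ
  unflip p i = k ∸ prevIter m p i

  unflip<m : ∀ p i → unflip p i < m
  unflip<m p i = s≤s (m∸n≤m k (prevIter m p i))

  unflip-flip : ∀ p i → i < m → unflip p (flip p i) ≡ i
  unflip-flip p i i<m = trans (cong (λ j → k ∸ prevIter m p j) (flip≡shift p i i<m))
    (trans (cong (k ∸_) (prevIter-shift p (k ∸ i) (s≤s (m∸n≤m k i)))) (m∸[m∸n]≡n (≤-pred i<m)))

  flip-unflip : ∀ p i → i < m → flip p (unflip p i) ≡ i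
  flip-unflip p i i<m = trans (flip≡shift p (unflip p i) (unflip<m p i))
    (trans (cong (shift p) (m∸[m∸n]≡n (≤-pred (prevIter<m p i i<m)))) (shift-prevIter p i i<m))

  kleinTwist : ℕ → Twist k
  kleinTwist p = record
    { σ = flip p ; τ = unflip p
    ; σ<m = λ i _ → m%n<n (m + p ∸ suc i) m ; τ<m = λ i _ → unflip<m p i
    ; τ∘σ = unflip-flip p ; σ∘τ = flip-unflip p
    ; glue = rhoInvP p ∘ conv
    ; hasLeft-glue = λ x i i<m → trans
        (cong hasLeft (trans (‼-rhoInvP p (conv x) i i<m) (‼-conv x (prevIter m p i) (prevIter<m p i i<m)))) (hasLeft-bar _)
    ; glue-vertex = λ x vx → rhoInvP-vertex p (conv x) (conv-vertex x vx) }

-- Vertices of D_m and powers of T_m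

sumOver-allWords-select : ∀ m (u : Word m) (h : Word m → ℕ) → sumOver (allWords m) (λ v → ind (eqW v u) * h v) ≡ h u
sumOver-allWords-select zero [] h = trans (+-identityʳ _) (+-identityʳ (h []))
sumOver-allWords-select (suc m) (x ∷ u) h = begin
    sumOver (concatMap (λ y → map (y ∷_) (allWords m)) letters) (λ v → ind (eqW v (x ∷ u)) * h v)
  ≡⟨ sumOver-concatMap (λ y → map (y ∷_) (allWords m)) letters _ ⟩
    sumOver letters (λ y → sumOver (map (y ∷_) (allWords m)) (λ v → ind (eqW v (x ∷ u)) * h v))
  ≡⟨ sumOver-cong letters (λ y → trans (sumOver-map (y ∷_) (allWords m) (λ v → ind (eqW v (x ∷ u)) * h v))
       (trans (sumOver-cong (allWords m) (λ v → trans (cong (_* h (y ∷ v)) (ind-∧ (eqL y x) (eqW v u))) (*-assoc (ind (eqL y x)) _ _)))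
       (trans (sumOver-*ˡ (allWords m) (ind (eqL y x)) _) (cong (ind (eqL y x) *_) (sumOver-allWords-select m u (λ v → h (y ∷ v))))))) ⟩
    sumOver letters (λ y → ind (eqL y x) * h (y ∷ u))
  ≡⟨ select-letter x ⟩
    h (x ∷ u)
  ∎
  where
  select-letter : ∀ x → sumOver letters (λ y → ind (eqL y x) * h (y ∷ u)) ≡ h (x ∷ u)
  select-letter a = trans (+-identityʳ _) (+-identityʳ _)
  select-letter b = trans (+-identityʳ _) (+-identityʳ _)
  select-letter c = trans (+-identityʳ _) (+-identityʳ _)
  select-letter d = trans (+-identityʳ _) (+-identityʳ _)
  select-letter e = trans (+-identityʳ _) (+-identityʳ _)
  select-letter f = trans (+-identityʳ _) (+-identityʳ _)

module Digraph (k : ℕ) where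

  m : ℕ
  m = suc k

  Vertex : Word m → Set
  Vertex u = isVertex u ≡ true

  all-vertices : All Vertex (verts m)
  all-vertices = All-filterᵇ isVertex (allWords m)

  sumOver-verts-select : ∀ u (h : Word m → ℕ) → Vertex u → sumOver (verts m) (λ v → ind (eqW v u) * h v) ≡ h u
  sumOver-verts-select u h vu = begin
      sumOver (filterᵇ isVertex (allWords m)) (λ v → ind (eqW v u) * h v)
    ≡⟨ sumOver-filter isVertex (allWords m) _ ⟩
      sumOver (allWords m) (λ v → ind (isVertex v) * (ind (eqW v u) * h v))
    ≡⟨ sumOver-cong (allWords m) (λ v → x*[y*z]≡y*[x*z] (ind (isVertex v)) (ind (eqW v u)) (h v)) ⟩
      sumOver (allWords m) (λ v → ind (eqW v u) * (ind (isVertex v) * h v))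
    ≡⟨ sumOver-allWords-select m u (λ v → ind (isVertex v) * h v) ⟩
      ind (isVertex u) * h u
    ≡⟨ cong (λ x → ind x * h u) vu ⟩
      h u + 0
    ≡⟨ +-identityʳ (h u) ⟩
      h u
    ∎
    where
    x*[y*z]≡y*[x*z] : ∀ x y z → x * (y * z) ≡ y * (x * z)
    x*[y*z]≡y*[x*z] = solve-∀

  sumOver-verts-select′ : ∀ u (h : Word m → ℕ) → Vertex u → sumOver (verts m) (λ v → ind (eqW u v) * h v) ≡ h u
  sumOver-verts-select′ u h vu =
    trans (sumOver-cong (verts m) (λ v → cong (λ x → ind x * h v) (eqW-sym u v))) (sumOver-verts-select u h vu)

  columnSeqs : ℕ → List (List (Word m))
  columnSeqs zero = [] ∷ []
  columnSeqs (suc r) = concatMap (λ v → map (v ∷_) (columnSeqs r)) (verts m)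

  ColumnSeq : ℕ → List (Word m) → Set
  ColumnSeq r q = length q ≡ r × All Vertex q

  columnSeqs-sound : ∀ r → All (ColumnSeq r) (columnSeqs r)
  columnSeqs-sound zero = (refl , []) ∷ []
  columnSeqs-sound (suc r) = concat⁺ (map⁺ (All.map (λ vv → map⁺ (All.map (λ (len , vq) → cong suc len , vv ∷ vq) (columnSeqs-sound r))) all-vertices))

  columnSeqs-once : ∀ r q → ColumnSeq r q → sumOver (columnSeqs r) (λ q′ → ind (eqList eqW q′ q)) ≡ 1
  columnSeqs-once zero [] _ = refl
  columnSeqs-once (suc r) (x ∷ q) (len , vx ∷ vq) = begin
      sumOver (columnSeqs (suc r)) (λ q′ → ind (eqList eqW q′ (x ∷ q)))
    ≡⟨ sumOver-concatMap (λ v → map (v ∷_) (columnSeqs r)) (verts m) _ ⟩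
      sumOver (verts m) (λ v → sumOver (map (v ∷_) (columnSeqs r)) (λ q′ → ind (eqList eqW q′ (x ∷ q))))
    ≡⟨ sumOver-cong (verts m) (λ v → trans (sumOver-map (v ∷_) (columnSeqs r) _)
         (trans (sumOver-cong (columnSeqs r) (λ q′ → ind-∧ (eqW v x) (eqList eqW q′ q))) (sumOver-*ˡ (columnSeqs r) (ind (eqW v x)) _))) ⟩
      sumOver (verts m) (λ v → ind (eqW v x) * sumOver (columnSeqs r) (λ q′ → ind (eqList eqW q′ q)))
    ≡⟨ sumOver-cong (verts m) (λ v → cong (ind (eqW v x) *_) (columnSeqs-once r q (suc-injective len , vq))) ⟩
      sumOver (verts m) (λ v → ind (eqW v x) * 1)
    ≡⟨ sumOver-verts-select x (λ _ → 1) vx ⟩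
      1
    ∎

  chainWeight : Word m → List (Word m) → Word m → ℕ
  chainWeight x [] w = Tm m x w
  chainWeight x (y ∷ q) w = Tm m x y * chainWeight y q w

  mulM-assoc : ∀ A B C u w → mulM m (mulM m A B) C u w ≡ mulM m A (mulM m B C) u w
  mulM-assoc A B C u w = begin
      sumOver (verts m) (λ v → sumOver (verts m) (λ x → A u x * B x v) * C v w)
    ≡⟨ sumOver-cong (verts m) (λ v → trans (sym (sumOver-*ʳ (verts m) (C v w) (λ x → A u x * B x v)))
         (sumOver-cong (verts m) (λ x → *-assoc (A u x) (B x v) (C v w)))) ⟩
      sumOver (verts m) (λ v → sumOver (verts m) (λ x → A u x * (B x v * C v w)))
    ≡⟨ sumOver-swap (verts m) (verts m) (λ v x → A u x * (B x v * C v w)) ⟩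
      sumOver (verts m) (λ x → sumOver (verts m) (λ v → A u x * (B x v * C v w)))
    ≡⟨ sumOver-cong (verts m) (λ x → sumOver-*ˡ (verts m) (A u x) (λ v → B x v * C v w)) ⟩
      sumOver (verts m) (λ x → A u x * sumOver (verts m) (λ v → B x v * C v w))
    ∎

  trM-comm : ∀ A B → trM m (mulM m A B) ≡ trM m (mulM m B A)
  trM-comm A B = trans (sumOver-swap (verts m) (verts m) (λ u v → A u v * B v u))
    (sumOver-cong (verts m) (λ v → sumOver-cong (verts m) (λ u → *-comm (A u v) (B v u))))

  mulM-idˡ : ∀ M u w → Vertex u → mulM m (idM m) M u w ≡ M u w
  mulM-idˡ M u w vu = sumOver-verts-select′ u (λ v → M v w) vu

  mulM-idʳ : ∀ M u w → Vertex w → mulM m M (idM m) u w ≡ M u w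
  mulM-idʳ M u w vw = trans (sumOver-cong (verts m) (λ v → *-comm (M u v) (ind (eqW v w)))) (sumOver-verts-select w (M u) vw)

  powM-sucˡ : ∀ M r u w → Vertex u → Vertex w → powM m M (suc r) u w ≡ mulM m M (powM m M r) u w
  powM-sucˡ M zero u w vu vw = trans (mulM-idˡ M u w vu) (sym (mulM-idʳ M u w vw))
  powM-sucˡ M (suc r) u w vu vw = begin
      mulM m (powM m M (suc r)) M u w
    ≡⟨ sumOver-congᴬ (All.map (λ vv → cong (_* M _ w) (powM-sucˡ M r u _ vu vv)) all-vertices) ⟩
      mulM m (mulM m M (powM m M r)) M u w
    ≡⟨ mulM-assoc M (powM m M r) M u w ⟩
      mulM m M (powM m M (suc r)) u w
    ∎

  sumOver-chainWeight : ∀ r u w → Vertex u → Vertex w → sumOver (columnSeqs r) (λ q → chainWeight u q w) ≡ aK m (suc r) u w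
  sumOver-chainWeight zero u w vu _ = trans (+-identityʳ (Tm m u w)) (sym (mulM-idˡ (Tm m) u w vu))
  sumOver-chainWeight (suc r) u w vu vw = begin
      sumOver (concatMap (λ v → map (v ∷_) (columnSeqs r)) (verts m)) (λ q → chainWeight u q w)
    ≡⟨ sumOver-concatMap (λ v → map (v ∷_) (columnSeqs r)) (verts m) _ ⟩
      sumOver (verts m) (λ v → sumOver (map (v ∷_) (columnSeqs r)) (λ q → chainWeight u q w))
    ≡⟨ sumOver-cong (verts m) (λ v → trans (sumOver-map (v ∷_) (columnSeqs r) (λ q → chainWeight u q w))
         (sumOver-*ˡ (columnSeqs r) (Tm m u v) (λ q → chainWeight v q w))) ⟩
      sumOver (verts m) (λ v → Tm m u v * sumOver (columnSeqs r) (λ q → chainWeight v q w))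
    ≡⟨ sumOver-congᴬ (All.map (λ vv → cong (Tm m u _ *_) (sumOver-chainWeight r _ w vv vw)) all-vertices) ⟩
      mulM m (Tm m) (aK m (suc r)) u w
    ≡⟨ sym (powM-sucˡ (Tm m) (suc r) u w vu vw) ⟩
      aK m (suc (suc r)) u w
    ∎

  powM-Rm : ∀ p v u → Vertex v → powM m (Rm m) p v u ≡ ind (eqW u (rhoP p v))
  powM-Rm zero v u _ = cong ind (eqW-sym v u)
  powM-Rm (suc p) v u vv = begin
      sumOver (verts m) (λ x → powM m (Rm m) p v x * ind (eqW u (rho x)))
    ≡⟨ sumOver-cong (verts m) (λ x → cong (_* ind (eqW u (rho x))) (powM-Rm p v x vv)) ⟩
      sumOver (verts m) (λ x → ind (eqW x (rhoP p v)) * ind (eqW u (rho x)))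
    ≡⟨ sumOver-verts-select (rhoP p v) (λ x → ind (eqW u (rho x))) (rhoP-vertex p v vv) ⟩
      ind (eqW u (rho (rhoP p v)))
    ∎

-- Grids and their 2-factors

module Grid (k n′ : ℕ) (closed : Bool) (tw : Twist k) where
  open Twist tw
  open Digraph k

  n : ℕ
  n = suc n′

  vEdge hEdge : ℕ → ℕ → Edge
  vEdge i j = ((i , j) , (next m i , j))
  hEdge i j = ((i , j) , (i , suc j))

  closingEdge : ℕ → Edge
  closingEdge i = ((σ i , n′) , (i , 0))

  whenClosed : {A : Set} → Bool → (ℕ → A) → List A
  whenClosed true g = map g (upTo m)
  whenClosed false g = []

  closingCount : Bool → ℕ
  closingCount true = m
  closingCount false = 0

  length-whenClosed : ∀ {A : Set} x (g : ℕ → A) → length (whenClosed x g) ≡ closingCount x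
  length-whenClosed true g = length-map-upTo g m
  length-whenClosed false g = refl

  edges : List Edge
  edges = edgesTnC m n ++ whenClosed closed closingEdge

  edgeCount : ℕ
  edgeCount = (m * n + m * n′) + closingCount closed

  -- A selection lists the edges in the order of the edge list: vertical edges row by row,
  -- horizontal edges row by row, then the closing edges.
  record Choice : Set where
    constructor choice
    field
      vert horiz : ℕ → ℕ → Bool
      closing : ℕ → Bool
  open Choice public

  encode : Choice → List Bool
  encode β = (grid m n (vert β) ++ grid m n′ (horiz β)) ++ whenClosed closed (closing β)

  length-edges : length edges ≡ edgeCount
  length-edges = trans (List.length-++ (edgesTnC m n))
    (cong₂ _+_ (trans (List.length-++ (vertEdges m n)) (cong₂ _+_ (length-grid m n vEdge) (length-grid m n′ hEdge)))
               (length-whenClosed closed closingEdge))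

  length-encode : ∀ β → length (encode β) ≡ edgeCount
  length-encode β = trans (List.length-++ (grid m n (vert β) ++ grid m n′ (horiz β)))
    (cong₂ _+_ (trans (List.length-++ (grid m n (vert β))) (cong₂ _+_ (length-grid m n (vert β)) (length-grid m n′ (horiz β))))
               (length-whenClosed closed (closing β)))

  decode : List Bool → Choice
  decode s = choice (λ i j → lookupOr false (take (m * n) s) (i * n + j))
                    (λ i j → lookupOr false (take (m * n′) (drop (m * n) s)) (i * n′ + j))
                    (lookupOr false (drop (m * n′) (drop (m * n) s)))

  encode-decode : ∀ s → length s ≡ edgeCount → encode (decode s) ≡ s
  encode-decode s len = begin
      (grid m n (vert (decode s)) ++ grid m n′ (horiz (decode s))) ++ whenClosed closed (closing (decode s))
    ≡⟨ cong₂ (λ xs ys → (xs ++ ys) ++ whenClosed closed (closing (decode s)))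
         (grid-lookupOr false m n s₁ (length-take-≤ (m * n) s (≤-trans (m≤m+n (m * n) (m * n′)) (m≤m+n _ (closingCount closed))) len))
         (grid-lookupOr false m n′ s₂ (length-take-≤ (m * n′) (drop (m * n) s) (m≤m+n _ _) len-rest)) ⟩
      (s₁ ++ s₂) ++ whenClosed closed (lookupOr false s₃)
    ≡⟨ cong ((s₁ ++ s₂) ++_) (whenClosed-lookupOr closed s₃ len₃) ⟩
      (s₁ ++ s₂) ++ s₃
    ≡⟨ List.++-assoc s₁ s₂ s₃ ⟩
      s₁ ++ (s₂ ++ s₃)
    ≡⟨ cong (s₁ ++_) (List.take++drop≡id (m * n′) (drop (m * n) s)) ⟩
      s₁ ++ drop (m * n) s
    ≡⟨ List.take++drop≡id (m * n) s ⟩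
      s
    ∎
    where
    s₁ s₂ s₃ : List Bool
    s₁ = take (m * n) s
    s₂ = take (m * n′) (drop (m * n) s)
    s₃ = drop (m * n′) (drop (m * n) s)
    length-take-≤ : ∀ {A : Set} r (xs : List A) {l} → r ≤ l → length xs ≡ l → length (take r xs) ≡ r
    length-take-≤ r xs r≤l refl = trans (List.length-take r xs) (m≤n⇒m⊓n≡m r≤l)
    len-rest : length (drop (m * n) s) ≡ m * n′ + closingCount closed
    len-rest = trans (List.length-drop (m * n) s)
      (trans (cong (_∸ (m * n)) (trans len (+-assoc (m * n) (m * n′) _))) (m+n∸m≡n (m * n) _))
    len₃ : length s₃ ≡ closingCount closed
    len₃ = trans (List.length-drop (m * n′) (drop (m * n) s)) (trans (cong (_∸ (m * n′)) len-rest) (m+n∸m≡n (m * n′) _))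
    whenClosed-lookupOr : ∀ x (t : List Bool) → length t ≡ closingCount x → whenClosed x (lookupOr false t) ≡ t
    whenClosed-lookupOr true t len = map-lookupOr-upTo false t m len
    whenClosed-lookupOr false [] _ = refl

  record Agree (β β′ : Choice) : Set where
    field
      vert≡ : ∀ i j → i < m → j < n → vert β i j ≡ vert β′ i j
      horiz≡ : ∀ i j → i < m → j < n′ → horiz β i j ≡ horiz β′ i j
      closing≡ : closed ≡ true → ∀ i → i < m → closing β i ≡ closing β′ i

  encode-cong : ∀ β β′ → Agree β β′ → encode β ≡ encode β′
  encode-cong β β′ agree = cong₂ _++_
    (cong₂ _++_ (grid-cong m n (vert β) (vert β′) vert≡) (grid-cong m n′ (horiz β) (horiz β′) horiz≡))
    (whenClosed-cong closed closing≡)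
    where
    open Agree agree
    whenClosed-cong : ∀ x → (x ≡ true → ∀ i → i < m → closing β i ≡ closing β′ i) → whenClosed x (closing β) ≡ whenClosed x (closing β′)
    whenClosed-cong true eq = map-upTo-cong (closing β) (closing β′) m (eq refl)
    whenClosed-cong false _ = refl

  decode-encode : ∀ β → Agree (decode (encode β)) β
  decode-encode β = record { vert≡ = vert≡ ; horiz≡ = horiz≡ ; closing≡ = closing≡ }
    where
    V H X : List Bool
    V = grid m n (vert β)
    H = grid m n′ (horiz β)
    X = whenClosed closed (closing β)
    take-++ : ∀ {A : Set} (xs ys : List A) → take (length xs) (xs ++ ys) ≡ xs
    take-++ [] ys = refl
    take-++ (x ∷ xs) ys = cong (x ∷_) (take-++ xs ys)
    drop-++ : ∀ {A : Set} (xs ys : List A) → drop (length xs) (xs ++ ys) ≡ ys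
    drop-++ [] ys = refl
    drop-++ (x ∷ xs) ys = drop-++ xs ys
    split : encode β ≡ V ++ (H ++ X)
    split = List.++-assoc V H X
    lenV : length V ≡ m * n
    lenV = length-grid m n (vert β)
    lenH : length H ≡ m * n′
    lenH = length-grid m n′ (horiz β)
    rest : drop (m * n) (encode β) ≡ H ++ X
    rest = trans (cong (drop (m * n)) split) (subst (λ l → drop l (V ++ (H ++ X)) ≡ H ++ X) lenV (drop-++ V (H ++ X)))
    vert≡ : ∀ i j → i < m → j < n → lookupOr false (take (m * n) (encode β)) (i * n + j) ≡ vert β i j
    vert≡ i j i<m j<n = trans (cong (λ xs → lookupOr false (take (m * n) xs) (i * n + j)) split)
      (trans (cong (λ xs → lookupOr false xs (i * n + j)) (subst (λ l → take l (V ++ (H ++ X)) ≡ V) lenV (take-++ V (H ++ X))))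
             (lookupOr-grid false m n (vert β) i j i<m j<n))
    horiz≡ : ∀ i j → i < m → j < n′ → lookupOr false (take (m * n′) (drop (m * n) (encode β))) (i * n′ + j) ≡ horiz β i j
    horiz≡ i j i<m j<n′ = trans (cong (λ xs → lookupOr false (take (m * n′) xs) (i * n′ + j)) rest)
      (trans (cong (λ xs → lookupOr false xs (i * n′ + j)) (subst (λ l → take l (H ++ X) ≡ H) lenH (take-++ H X)))
             (lookupOr-grid false m n′ (horiz β) i j i<m j<n′))
    closing≡ : closed ≡ true → ∀ i → i < m → lookupOr false (drop (m * n′) (drop (m * n) (encode β))) i ≡ closing β i
    closing≡ refl i i<m = trans (cong (λ xs → lookupOr false (drop (m * n′) xs) i) rest)
      (trans (cong (λ xs → lookupOr false xs i) (subst (λ l → drop l (H ++ X) ≡ X) lenH (drop-++ H X)))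
             (lookupOr-map-upTo false (closing β) m i i<m))

  leftClosing rightClosing : Choice → ℕ → Bool
  leftClosing β i = closed ∧ closing β i
  rightClosing β i = closed ∧ closing β (τ i)

  upAt downAt leftAt rightAt : Choice → ℕ → ℕ → Bool
  upAt β i j = vert β (prev m i) j
  downAt β i j = vert β i j
  leftAt β i zero = leftClosing β i
  leftAt β i (suc j) = horiz β i j
  rightAt β i j = if j <ᵇ n′ then horiz β i j else rightClosing β i

  endCount : Choice → ℕ → ℕ → ℕ
  endCount β i j = (ind (downAt β i j) + ind (upAt β i j)) + (ind (leftAt β i j) + ind (rightAt β i j))

  chosenEnds : Pos → Bool → Edge → ℕ
  chosenEnds v chosen edge = if chosen then endsAt v edge else 0

  chosenEnds-vertical : ∀ ch A B J → (if ch then ind (A ∧ J) + ind (B ∧ J) else 0) ≡ ind J * (ind A * ind ch + ind B * ind ch)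
  chosenEnds-vertical ch A B J = trans (ind-if ch _) (trans (cong₂ (λ x y → ind ch * (x + y)) (ind-∧ A J) (ind-∧ B J))
    (shape (ind ch) (ind A) (ind B) (ind J)))
    where
    shape : ∀ x p q r → x * (p * r + q * r) ≡ r * (p * x + q * x)
    shape = solve-∀

  chosenEnds-horizontal : ∀ ch I A B → (if ch then ind (I ∧ A) + ind (I ∧ B) else 0) ≡ ind I * (ind A * ind ch + ind B * ind ch)
  chosenEnds-horizontal ch I A B = trans (ind-if ch _) (trans (cong₂ (λ x y → ind ch * (x + y)) (ind-∧ I A) (ind-∧ I B))
    (shape (ind ch) (ind I) (ind A) (ind B)))
    where
    shape : ∀ x r p q → x * (r * p + r * q) ≡ r * (p * x + q * x)
    shape = solve-∀

  chosenEnds-closing : ∀ ch A J B K → (if ch then ind (A ∧ J) + ind (B ∧ K) else 0) ≡ ind J * (ind A * ind ch) + ind K * (ind B * ind ch)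
  chosenEnds-closing ch A J B K = trans (ind-if ch _) (trans (cong₂ (λ x y → ind ch * (x + y)) (ind-∧ A J) (ind-∧ B K))
    (shape (ind ch) (ind A) (ind J) (ind B) (ind K)))
    where
    shape : ∀ x p r q s → x * (p * r + q * s) ≡ r * (p * x) + s * (q * x)
    shape = solve-∀

  degree-vertical : ∀ β i j → i < m → j < n →
    sum (zipWith (chosenEnds (i , j)) (grid m n (vert β)) (vertEdges m n)) ≡ ind (downAt β i j) + ind (upAt β i j)
  degree-vertical β i j i<m j<n = begin
      sum (zipWith (chosenEnds (i , j)) (grid m n (vert β)) (grid m n vEdge))
    ≡⟨ cong sum (zipWith-grid (chosenEnds (i , j)) m n (vert β) vEdge) ⟩
      sum (grid m n (λ x y → chosenEnds (i , j) (vert β x y) (vEdge x y)))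
    ≡⟨ sum-grid m n _ ⟩
      sumOver (upTo m) (λ x → sumOver (upTo n) (λ y → chosenEnds (i , j) (vert β x y) (vEdge x y)))
    ≡⟨ sumOver-cong (upTo m) (λ x → sumOver-cong (upTo n) (λ y →
         chosenEnds-vertical (vert β x y) (i ≡ᵇ x) (i ≡ᵇ next m x) (j ≡ᵇ y))) ⟩
      sumOver (upTo m) (λ x → sumOver (upTo n) (λ y →
        ind (j ≡ᵇ y) * (ind (i ≡ᵇ x) * ind (vert β x y) + ind (i ≡ᵇ next m x) * ind (vert β x y))))
    ≡⟨ sumOver-cong (upTo m) (λ x → sumOver-upTo-select< n j _ j<n) ⟩
      sumOver (upTo m) (λ x → ind (i ≡ᵇ x) * ind (vert β x j) + ind (i ≡ᵇ next m x) * ind (vert β x j))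
    ≡⟨ sumOver-+ (upTo m) (λ x → ind (i ≡ᵇ x) * ind (vert β x j)) (λ x → ind (i ≡ᵇ next m x) * ind (vert β x j)) ⟩
      sumOver (upTo m) (λ x → ind (i ≡ᵇ x) * ind (vert β x j)) + sumOver (upTo m) (λ x → ind (i ≡ᵇ next m x) * ind (vert β x j))
    ≡⟨ cong₂ _+_ (sumOver-upTo-select< m i _ i<m)
                 (sumOver-upTo-select-bij m (next m) (prev m) i _ prev-next (next-prev i i<m) (prev<m i i<m)) ⟩
      ind (vert β i j) + ind (vert β (prev m i) j)
    ∎

  horizLeft : Choice → ℕ → ℕ → ℕ
  horizLeft β i zero = 0
  horizLeft β i (suc j) = ind (j <ᵇ n′) * ind (horiz β i j)

  degree-horizontal : ∀ β i j → i < m →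
    sum (zipWith (chosenEnds (i , j)) (grid m n′ (horiz β)) (horEdges m n)) ≡ ind (j <ᵇ n′) * ind (horiz β i j) + horizLeft β i j
  degree-horizontal β i j i<m = begin
      sum (zipWith (chosenEnds (i , j)) (grid m n′ (horiz β)) (grid m n′ hEdge))
    ≡⟨ cong sum (zipWith-grid (chosenEnds (i , j)) m n′ (horiz β) hEdge) ⟩
      sum (grid m n′ (λ x y → chosenEnds (i , j) (horiz β x y) (hEdge x y)))
    ≡⟨ sum-grid m n′ _ ⟩
      sumOver (upTo m) (λ x → sumOver (upTo n′) (λ y → chosenEnds (i , j) (horiz β x y) (hEdge x y)))
    ≡⟨ sumOver-cong (upTo m) (λ x → trans (sumOver-cong (upTo n′) (λ y →
         chosenEnds-horizontal (horiz β x y) (i ≡ᵇ x) (j ≡ᵇ y) (j ≡ᵇ suc y))) (sumOver-*ˡ (upTo n′) (ind (i ≡ᵇ x)) _)) ⟩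
      sumOver (upTo m) (λ x → ind (i ≡ᵇ x) * sumOver (upTo n′) (λ y →
        ind (j ≡ᵇ y) * ind (horiz β x y) + ind (j ≡ᵇ suc y) * ind (horiz β x y)))
    ≡⟨ sumOver-upTo-select< m i _ i<m ⟩
      sumOver (upTo n′) (λ y → ind (j ≡ᵇ y) * ind (horiz β i y) + ind (j ≡ᵇ suc y) * ind (horiz β i y))
    ≡⟨ sumOver-+ (upTo n′) (λ y → ind (j ≡ᵇ y) * ind (horiz β i y)) (λ y → ind (j ≡ᵇ suc y) * ind (horiz β i y)) ⟩
      sumOver (upTo n′) (λ y → ind (j ≡ᵇ y) * ind (horiz β i y)) + sumOver (upTo n′) (λ y → ind (j ≡ᵇ suc y) * ind (horiz β i y))
    ≡⟨ cong₂ _+_ (sumOver-upTo-select n′ j _) (left-ends j) ⟩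
      ind (j <ᵇ n′) * ind (horiz β i j) + horizLeft β i j
    ∎
    where
    left-ends : ∀ j → sumOver (upTo n′) (λ y → ind (j ≡ᵇ suc y) * ind (horiz β i y)) ≡ horizLeft β i j
    left-ends zero = sumOver-zero (upTo n′)
    left-ends (suc j) = sumOver-upTo-select n′ j _

  degree-closing : ∀ β i j → i < m →
    sum (zipWith (chosenEnds (i , j)) (whenClosed closed (closing β)) (whenClosed closed closingEdge))
      ≡ ind (j ≡ᵇ n′) * ind (rightClosing β i) + ind (j ≡ᵇ 0) * ind (leftClosing β i)
  degree-closing β i j i<m = go closed
    where
    go : ∀ x → sum (zipWith (chosenEnds (i , j)) (whenClosed x (closing β)) (whenClosed x closingEdge))
           ≡ ind (j ≡ᵇ n′) * ind (x ∧ closing β (τ i)) + ind (j ≡ᵇ 0) * ind (x ∧ closing β i)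
    go false = sym (cong₂ _+_ (*-zeroʳ (ind (j ≡ᵇ n′))) (*-zeroʳ (ind (j ≡ᵇ 0))))
    go true = begin
        sum (zipWith (chosenEnds (i , j)) (map (closing β) (upTo m)) (map closingEdge (upTo m)))
      ≡⟨ cong sum (zipWith-map-upTo (chosenEnds (i , j)) (closing β) closingEdge m) ⟩
        sumOver (upTo m) (λ x → chosenEnds (i , j) (closing β x) (closingEdge x))
      ≡⟨ sumOver-cong (upTo m) (λ x → chosenEnds-closing (closing β x) (i ≡ᵇ σ x) (j ≡ᵇ n′) (i ≡ᵇ x) (j ≡ᵇ 0)) ⟩
        sumOver (upTo m) (λ x → ind (j ≡ᵇ n′) * (ind (i ≡ᵇ σ x) * ind (closing β x)) + ind (j ≡ᵇ 0) * (ind (i ≡ᵇ x) * ind (closing β x)))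
      ≡⟨ trans (sumOver-+ (upTo m) (λ x → ind (j ≡ᵇ n′) * (ind (i ≡ᵇ σ x) * ind (closing β x))) (λ x → ind (j ≡ᵇ 0) * (ind (i ≡ᵇ x) * ind (closing β x)))) (cong₂ _+_ (sumOver-*ˡ (upTo m) (ind (j ≡ᵇ n′)) _) (sumOver-*ˡ (upTo m) (ind (j ≡ᵇ 0)) _)) ⟩
        ind (j ≡ᵇ n′) * sumOver (upTo m) (λ x → ind (i ≡ᵇ σ x) * ind (closing β x))
          + ind (j ≡ᵇ 0) * sumOver (upTo m) (λ x → ind (i ≡ᵇ x) * ind (closing β x))
      ≡⟨ cong₂ (λ r l → ind (j ≡ᵇ n′) * r + ind (j ≡ᵇ 0) * l)
           (sumOver-upTo-select-bij m σ τ i _ τ∘σ (σ∘τ i i<m) (τ<m i i<m)) (sumOver-upTo-select< m i _ i<m) ⟩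
        ind (j ≡ᵇ n′) * ind (closing β (τ i)) + ind (j ≡ᵇ 0) * ind (closing β i)
      ∎

  left-end : ∀ β i j → j < n → horizLeft β i j + ind (j ≡ᵇ 0) * ind (leftClosing β i) ≡ ind (leftAt β i j)
  left-end β i zero _ = +-identityʳ _
  left-end β i (suc j) (s≤s j<n′) = trans (+-identityʳ _) (trans (cong (λ x → ind x * ind (horiz β i j)) (<⇒<ᵇ≡true j<n′)) (+-identityʳ _))

  right-end : ∀ β i j → j < n → ind (j <ᵇ n′) * ind (horiz β i j) + ind (j ≡ᵇ n′) * ind (rightClosing β i) ≡ ind (rightAt β i j)
  right-end β i j (s≤s j≤n′) = ind-select (j <ᵇ n′) (j ≡ᵇ n′) (<ᵇ≡not≡ᵇ j n′ j≤n′) _ _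

  degree-encode : ∀ β i j → i < m → j < n → degree edges (encode β) (i , j) ≡ endCount β i j
  degree-encode β i j i<m j<n = begin
      sum (zipWith ends ((V ++ H) ++ X) ((vertEdges m n ++ horEdges m n) ++ XE))
    ≡⟨ cong sum (zipWith-++ ends (V ++ H) X (vertEdges m n ++ horEdges m n) XE
         (trans (length-++-grids (vert β) (horiz β)) (sym (length-++-grids vEdge hEdge)))) ⟩
      sum (zipWith ends (V ++ H) (vertEdges m n ++ horEdges m n) ++ zipWith ends X XE)
    ≡⟨ sum-++ (zipWith ends (V ++ H) (vertEdges m n ++ horEdges m n)) _ ⟩
      sum (zipWith ends (V ++ H) (vertEdges m n ++ horEdges m n)) + sum (zipWith ends X XE)
    ≡⟨ cong (_+ sum (zipWith ends X XE)) (trans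
         (cong sum (zipWith-++ ends V H (vertEdges m n) (horEdges m n) (trans (length-grid m n (vert β)) (sym (length-grid m n vEdge)))))
         (sum-++ (zipWith ends V (vertEdges m n)) _)) ⟩
      (sum (zipWith ends V (vertEdges m n)) + sum (zipWith ends H (horEdges m n))) + sum (zipWith ends X XE)
    ≡⟨ cong₂ _+_ (cong₂ _+_ (degree-vertical β i j i<m j<n) (degree-horizontal β i j i<m)) (degree-closing β i j i<m) ⟩
      (ind (downAt β i j) + ind (upAt β i j)) + (ind (j <ᵇ n′) * ind (horiz β i j) + horizLeft β i j)
        + (ind (j ≡ᵇ n′) * ind (rightClosing β i) + ind (j ≡ᵇ 0) * ind (leftClosing β i))
    ≡⟨ regroup (ind (downAt β i j) + ind (upAt β i j)) (ind (j <ᵇ n′) * ind (horiz β i j)) (horizLeft β i j)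
                 (ind (j ≡ᵇ n′) * ind (rightClosing β i)) (ind (j ≡ᵇ 0) * ind (leftClosing β i)) ⟩
      (ind (downAt β i j) + ind (upAt β i j))
        + ((horizLeft β i j + ind (j ≡ᵇ 0) * ind (leftClosing β i)) + (ind (j <ᵇ n′) * ind (horiz β i j) + ind (j ≡ᵇ n′) * ind (rightClosing β i)))
    ≡⟨ cong₂ (λ l r → (ind (downAt β i j) + ind (upAt β i j)) + (l + r)) (left-end β i j j<n) (right-end β i j j<n) ⟩
      endCount β i j
    ∎
    where
    ends : Bool → Edge → ℕ
    ends = chosenEnds (i , j)
    V H X : List Bool
    V = grid m n (vert β)
    H = grid m n′ (horiz β)
    X = whenClosed closed (closing β)
    XE : List Edge
    XE = whenClosed closed closingEdge
    length-++-grids : ∀ {A : Set} (g h : ℕ → ℕ → A) → length (grid m n g ++ grid m n′ h) ≡ m * n + m * n′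
    length-++-grids g h = trans (List.length-++ (grid m n g)) (cong₂ _+_ (length-grid m n g) (length-grid m n′ h))
    regroup : ∀ v r lh rc lc → v + (r + lh) + (rc + lc) ≡ v + ((lh + lc) + (r + rc))
    regroup = solve-∀

  column : List (Word m) → ℕ → Word m
  column q j = lookupOr (bm m) q j

  openLeft : Word m → Bool
  openLeft x = if closed then true else allIn abc x

  openLeft⇒ : ∀ x → openLeft x ≡ true → closed ≡ false → ∀ i → i < m → hasLeft (x ‼ i) ≡ false
  openLeft⇒ x ok refl = allIn-abc⇒ x ok

  openLeft⇐ : ∀ x → (closed ≡ false → ∀ i → i < m → hasLeft (x ‼ i) ≡ false) → openLeft x ≡ true
  openLeft⇐ x noLeft = go closed noLeft
    where
    go : ∀ cl → (cl ≡ false → ∀ i → i < m → hasLeft (x ‼ i) ≡ false) → (if cl then true else allIn abc x) ≡ true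
    go true _ = refl
    go false noLeft = allIn-abc⇐ x (noLeft refl)

  chainOK : Word m → List (Word m) → Word m → Bool
  chainOK x [] w = vAll lrArc x w
  chainOK x (y ∷ q) w = vAll lrArc x y ∧ chainOK y q w

  validColumns : List (Word m) → Bool
  validColumns [] = false
  validColumns (x ∷ q) = openLeft x ∧ chainOK x q (glue x)

  IsColumns : List (Word m) → Bool
  IsColumns q = (length q ≡ᵇ n) ∧ (all isVertex q ∧ validColumns q)

  IsTwoFactor : List Bool → Bool
  IsTwoFactor s = (length s ≡ᵇ edgeCount) ∧ isTwoFactor m n edges s

  chainOK⇒ : ∀ x q w → chainOK x q w ≡ true →
    (∀ j → j < length q → vAll lrArc (column (x ∷ q) j) (column (x ∷ q) (suc j)) ≡ true)
      × vAll lrArc (column (x ∷ q) (length q)) w ≡ true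
  chainOK⇒ x [] w ok = (λ _ ()) , ok
  chainOK⇒ x (y ∷ q) w ok with ∧-true {vAll lrArc x y} ok
  ... | xy , rest = (λ { zero _ → xy ; (suc j) (s≤s j<) → proj₁ (chainOK⇒ y q w rest) j j< }) , proj₂ (chainOK⇒ y q w rest)

  chainOK⇐ : ∀ x q w → (∀ j → j < length q → vAll lrArc (column (x ∷ q) j) (column (x ∷ q) (suc j)) ≡ true) →
    vAll lrArc (column (x ∷ q) (length q)) w ≡ true → chainOK x q w ≡ true
  chainOK⇐ x [] w _ last = last
  chainOK⇐ x (y ∷ q) w steps last = ∧-intro (steps 0 (s≤s z≤n)) (chainOK⇐ y q w (λ j j< → steps (suc j) (s≤s j<)) last)

  record Columns (q : List (Word m)) : Set where
    field
      len : length q ≡ n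
      vertices : ∀ j → j < n → Vertex (column q j)
      matching : ∀ j → suc j < n → ∀ i → i < m → hasRight (column q j ‼ i) ≡ hasLeft (column q (suc j) ‼ i)
      closing-matching : ∀ i → i < m → hasRight (column q n′ ‼ i) ≡ hasLeft (column q 0 ‼ τ i)
      open-left : closed ≡ false → ∀ i → i < m → hasLeft (column q 0 ‼ i) ≡ false

  IsColumns⇒ : ∀ q → IsColumns q ≡ true → Columns q
  IsColumns⇒ (x ∷ q) ok with ∧-true {length (x ∷ q) ≡ᵇ n} ok
  ... | len-ok , rest with ∧-true {all isVertex (x ∷ q)} rest
  ... | all-ok , valid with ∧-true {openLeft x} valid
  ... | left-ok , chain-ok = record
    { len = len
    ; vertices = λ j j<n → All-lookupOr⁻ (bm m) (x ∷ q) (all≡true⇒ isVertex (x ∷ q) all-ok) j (subst (j <_) (sym len) j<n)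
    ; matching = λ j 1+j<n → lrArcs⇒ (column (x ∷ q) j) (column (x ∷ q) (suc j)) (proj₁ steps j (subst (suc j ≤_) (sym (suc-injective len)) (≤-pred 1+j<n)))
    ; closing-matching = λ i i<m → trans
        (subst (λ l → hasRight (column (x ∷ q) l ‼ i) ≡ hasLeft (glue x ‼ i)) (suc-injective len) (lrArcs⇒ (column (x ∷ q) (length q)) (glue x) (proj₂ steps) i i<m))
        (hasLeft-glue x i i<m)
    ; open-left = openLeft⇒ x left-ok
    }
    where
    len : length (x ∷ q) ≡ n
    len = ≡ᵇ≡true⇒≡ len-ok
    steps : (∀ j → j < length q → vAll lrArc (column (x ∷ q) j) (column (x ∷ q) (suc j)) ≡ true)
              × vAll lrArc (column (x ∷ q) (length q)) (glue x) ≡ true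
    steps = chainOK⇒ x q (glue x) chain-ok

  Columns⇒IsColumns : ∀ q → Columns q → IsColumns q ≡ true
  Columns⇒IsColumns (x ∷ q) cols = ∧-intro (≡⇒≡ᵇ≡true len)
    (∧-intro (all≡true⇐ isVertex (x ∷ q) (All-lookupOr⁺ (bm m) (x ∷ q) (λ j j< → vertices j (subst (j <_) len j<))))
    (∧-intro (openLeft⇐ x open-left) (chainOK⇐ x q (glue x)
      (λ j j< → lrArcs⇐ (column (x ∷ q) j) (column (x ∷ q) (suc j)) (matching j (subst (suc j <_) len (s≤s j<))))
      (lrArcs⇐ (column (x ∷ q) (length q)) (glue x) (λ i i<m → trans
         (subst (λ l → hasRight (column (x ∷ q) l ‼ i) ≡ hasLeft (x ‼ τ i)) (sym (suc-injective len)) (closing-matching i i<m))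
         (sym (hasLeft-glue x i i<m)))))))
    where
    open Columns cols

  choiceOf : List (Word m) → Choice
  choiceOf q = choice (λ i j → hasDown (column q j ‼ i)) (λ i j → hasRight (column q j ‼ i)) (λ i → hasLeft (column q 0 ‼ i))

  EndsAt : Choice → ℕ → ℕ → Letter → Set
  EndsAt β i j x = HasEnds x (upAt β i j) (downAt β i j) (leftAt β i j) (rightAt β i j)

  endCount≡2 : ∀ β i j x → EndsAt β i j x → endCount β i j ≡ 2
  endCount≡2 β i j x ends = begin
      (ind (downAt β i j) + ind (upAt β i j)) + (ind (leftAt β i j) + ind (rightAt β i j))
    ≡⟨ cong₂ (λ dn up → (ind dn + ind up) + (ind (leftAt β i j) + ind (rightAt β i j))) (sym down≡) (sym up≡) ⟩
      (ind (hasDown x) + ind (hasUp x)) + (ind (leftAt β i j) + ind (rightAt β i j))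
    ≡⟨ cong₂ (λ lt rt → (ind (hasDown x) + ind (hasUp x)) + (ind lt + ind rt)) (sym left≡) (sym right≡) ⟩
      (ind (hasDown x) + ind (hasUp x)) + (ind (hasLeft x) + ind (hasRight x))
    ≡⟨ letter-degree x ⟩
      2
    ∎
    where
    open HasEnds ends

  choiceOf-ends : ∀ q → Columns q → ∀ i j → i < m → j < n → EndsAt (choiceOf q) i j (column q j ‼ i)
  choiceOf-ends q cols i j i<m j<n = record { up≡ = up≡ ; down≡ = refl ; left≡ = left≡ j j<n ; right≡ = right≡ }
    where
    open Columns cols
    up≡ : hasUp (column q j ‼ i) ≡ hasDown (column q j ‼ prev m i)
    up≡ = sym (trans (isVertex⇒ (column q j) (vertices j j<n) (prev m i) (prev<m i i<m)) (cong (λ l → hasUp (column q j ‼ l)) (next-prev i i<m)))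
    left≡ : ∀ j → j < n → hasLeft (column q j ‼ i) ≡ leftAt (choiceOf q) i j
    left≡ zero _ = sym (∧-absorbˡ closed _ (λ isOpen → open-left isOpen i i<m))
    left≡ (suc j) 1+j<n = sym (matching j 1+j<n i i<m)
    right≡ : hasRight (column q j ‼ i) ≡ rightAt (choiceOf q) i j
    right≡ with j <ᵇ n′ in j<ᵇn′
    ... | true = refl
    ... | false = begin
        hasRight (column q j ‼ i)        ≡⟨ cong (λ l → hasRight (column q l ‼ i)) (<ᵇ≡false⇒≡ j n′ (≤-pred j<n) j<ᵇn′) ⟩
        hasRight (column q n′ ‼ i)       ≡⟨ closing-matching i i<m ⟩
        hasLeft (column q 0 ‼ τ i)       ≡⟨ sym (∧-absorbˡ closed _ (λ isOpen → open-left isOpen (τ i) (τ<m i i<m))) ⟩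
        rightClosing (choiceOf q) i      ∎

  IsTwoFactor⇐ : ∀ s → length s ≡ edgeCount → (∀ i j → i < m → j < n → degree edges s (i , j) ≡ 2) → IsTwoFactor s ≡ true
  IsTwoFactor⇐ s len deg2 = ∧-intro (≡⇒≡ᵇ≡true len)
    (all≡true⇐ _ (gridVerts m n) (All-grid⁺ m n _,_ (λ i j i<m j<n → ≡⇒≡ᵇ≡true (deg2 i j i<m j<n))))

  IsTwoFactor⇒ : ∀ s → IsTwoFactor s ≡ true → length s ≡ edgeCount × (∀ i j → i < m → j < n → degree edges s (i , j) ≡ 2)
  IsTwoFactor⇒ s ok with ∧-true {length s ≡ᵇ edgeCount} ok
  ... | len-ok , deg-ok = ≡ᵇ≡true⇒≡ len-ok , λ i j i<m j<n →
    ≡ᵇ≡true⇒≡ (All-grid⁻ {P = λ v → (degree edges s v ≡ᵇ 2) ≡ true} m n _,_ (all≡true⇒ _ (gridVerts m n) deg-ok) i j i<m j<n)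

  encodeColumns : List (Word m) → List Bool
  encodeColumns q = encode (choiceOf q)

  encodeColumns-twoFactor : ∀ q → IsColumns q ≡ true → IsTwoFactor (encodeColumns q) ≡ true
  encodeColumns-twoFactor q ok = IsTwoFactor⇐ (encodeColumns q) (length-encode (choiceOf q)) (λ i j i<m j<n →
    trans (degree-encode (choiceOf q) i j i<m j<n) (endCount≡2 (choiceOf q) i j _ (choiceOf-ends q cols i j i<m j<n)))
    where
    cols : Columns q
    cols = IsColumns⇒ q ok

  letterAt : Choice → ℕ → ℕ → Letter
  letterAt β i j = letterWith (upAt β i j) (downAt β i j) (leftAt β i j) (rightAt β i j)

  decodeColumns : List Bool → List (Word m)
  decodeColumns s = map (λ j → tabulateW m (λ i → letterAt (decode s) i j)) (upTo n)

  decode-ends : ∀ s → IsTwoFactor s ≡ true → ∀ i j → i < m → j < n → EndsAt (decode s) i j (letterAt (decode s) i j)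
  decode-ends s ok i j i<m j<n = hasEnds-letterWith _ _ _ _ (begin
      endCount (decode s) i j                    ≡⟨ sym (degree-encode (decode s) i j i<m j<n) ⟩
      degree edges (encode (decode s)) (i , j)   ≡⟨ cong (λ s′ → degree edges s′ (i , j)) (encode-decode s (proj₁ (IsTwoFactor⇒ s ok))) ⟩
      degree edges s (i , j)                     ≡⟨ proj₂ (IsTwoFactor⇒ s ok) i j i<m j<n ⟩
      2                                          ∎)

  ‼-decodeColumns : ∀ s i j → i < m → j < n → column (decodeColumns s) j ‼ i ≡ letterAt (decode s) i j
  ‼-decodeColumns s i j i<m j<n = trans (cong (_‼ i) (lookupOr-map-upTo (bm m) _ n j j<n)) (‼-tabulateW m (λ i′ → letterAt (decode s) i′ j) i i<m)

  decodeColumns-columns : ∀ s → IsTwoFactor s ≡ true → IsColumns (decodeColumns s) ≡ true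
  decodeColumns-columns s ok = Columns⇒IsColumns (decodeColumns s) (record
    { len = length-map-upTo _ n
    ; vertices = λ j j<n → isVertex⇐ (column cols j) (λ i i<m → begin
        hasDown (column cols j ‼ i)            ≡⟨ cong hasDown (‼-decodeColumns s i j i<m j<n) ⟩
        hasDown (letterAt β i j)               ≡⟨ down≡ (ends i j i<m j<n) ⟩
        vert β i j                             ≡⟨ cong (λ l → vert β l j) (sym (prev-next i i<m)) ⟩
        vert β (prev m (next m i)) j           ≡⟨ sym (up≡ (ends (next m i) j (next<m i) j<n)) ⟩
        hasUp (letterAt β (next m i) j)        ≡⟨ cong hasUp (sym (‼-decodeColumns s (next m i) j (next<m i) j<n)) ⟩
        hasUp (column cols j ‼ next m i)       ∎)
    ; matching = λ j 1+j<n i i<m → begin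
        hasRight (column cols j ‼ i)           ≡⟨ cong hasRight (‼-decodeColumns s i j i<m (<-trans (n<1+n j) 1+j<n)) ⟩
        hasRight (letterAt β i j)              ≡⟨ right≡ (ends i j i<m (<-trans (n<1+n j) 1+j<n)) ⟩
        rightAt β i j                          ≡⟨ if-true (<⇒<ᵇ≡true (≤-pred 1+j<n)) ⟩
        horiz β i j                            ≡⟨ sym (left≡ (ends i (suc j) i<m 1+j<n)) ⟩
        hasLeft (letterAt β i (suc j))         ≡⟨ cong hasLeft (sym (‼-decodeColumns s i (suc j) i<m 1+j<n)) ⟩
        hasLeft (column cols (suc j) ‼ i)      ∎
    ; closing-matching = λ i i<m → begin
        hasRight (column cols n′ ‼ i)          ≡⟨ cong hasRight (‼-decodeColumns s i n′ i<m (n<1+n n′)) ⟩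
        hasRight (letterAt β i n′)             ≡⟨ right≡ (ends i n′ i<m (n<1+n n′)) ⟩
        rightAt β i n′                         ≡⟨ cong (λ x → if x then horiz β i n′ else rightClosing β i) (n<ᵇn≡false n′) ⟩
        rightClosing β i                       ≡⟨ sym (left≡ (ends (τ i) 0 (τ<m i i<m) (s≤s z≤n))) ⟩
        hasLeft (letterAt β (τ i) 0)           ≡⟨ cong hasLeft (sym (‼-decodeColumns s (τ i) 0 (τ<m i i<m) (s≤s z≤n))) ⟩
        hasLeft (column cols 0 ‼ τ i)          ∎
    ; open-left = λ isOpen i i<m →
        trans (cong hasLeft (‼-decodeColumns s i 0 i<m (s≤s z≤n)))
        (trans (left≡ (ends i 0 i<m (s≤s z≤n))) (cong (_∧ closing β i) isOpen))
    })
    where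
    β : Choice
    β = decode s
    cols : List (Word m)
    cols = decodeColumns s
    ends : ∀ i j → i < m → j < n → EndsAt β i j (letterAt β i j)
    ends = decode-ends s ok
    open HasEnds

  letterAt-cong : ∀ β β′ → Agree β β′ → ∀ i j → i < m → j < n → letterAt β i j ≡ letterAt β′ i j
  letterAt-cong β β′ agree i j i<m j<n = trans
    (cong₂ (λ up dn → letterWith up dn (leftAt β i j) (rightAt β i j)) (vert≡ (prev m i) j (prev<m i i<m) j<n) (vert≡ i j i<m j<n))
    (cong₂ (letterWith (upAt β′ i j) (downAt β′ i j)) (left-agrees j j<n) right-agrees)
    where
    open Agree agree
    left-agrees : ∀ j → j < n → leftAt β i j ≡ leftAt β′ i j
    left-agrees zero _ = ∧-congˡ closed (λ cl → closing≡ cl i i<m)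
    left-agrees (suc j) (s≤s j<n′) = horiz≡ i j i<m j<n′
    right-agrees : rightAt β i j ≡ rightAt β′ i j
    right-agrees with j <ᵇ n′ in j<ᵇn′
    ... | true = horiz≡ i j i<m (<ᵇ⇒< j n′ (subst T (sym j<ᵇn′) _))
    ... | false = ∧-congˡ closed (λ cl → closing≡ cl (τ i) (τ<m i i<m))

  encode-decodeColumns : ∀ s → IsTwoFactor s ≡ true → encodeColumns (decodeColumns s) ≡ s
  encode-decodeColumns s ok = trans (encode-cong (choiceOf cols) β (record { vert≡ = vert≡ ; horiz≡ = horiz≡ ; closing≡ = closing≡ }))
    (encode-decode s (proj₁ (IsTwoFactor⇒ s ok)))
    where
    β : Choice
    β = decode s
    cols : List (Word m)
    cols = decodeColumns s
    ends : ∀ i j → i < m → j < n → EndsAt β i j (letterAt β i j)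
    ends = decode-ends s ok
    open HasEnds
    vert≡ : ∀ i j → i < m → j < n → hasDown (column cols j ‼ i) ≡ vert β i j
    vert≡ i j i<m j<n = trans (cong hasDown (‼-decodeColumns s i j i<m j<n)) (down≡ (ends i j i<m j<n))
    horiz≡ : ∀ i j → i < m → j < n′ → hasRight (column cols j ‼ i) ≡ horiz β i j
    horiz≡ i j i<m j<n′ = trans (cong hasRight (‼-decodeColumns s i j i<m (<-trans j<n′ (n<1+n n′))))
      (trans (right≡ (ends i j i<m (<-trans j<n′ (n<1+n n′)))) (if-true (<⇒<ᵇ≡true j<n′)))
    closing≡ : closed ≡ true → ∀ i → i < m → hasLeft (column cols 0 ‼ i) ≡ closing β i
    closing≡ isClosed i i<m = trans (cong hasLeft (‼-decodeColumns s i 0 i<m (s≤s z≤n)))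
      (trans (left≡ (ends i 0 i<m (s≤s z≤n))) (cong (_∧ closing β i) isClosed))

  decodeColumns-encode : ∀ q → IsColumns q ≡ true → decodeColumns (encodeColumns q) ≡ q
  decodeColumns-encode q ok = trans (map-upTo-cong _ (column q) n same-column) (map-lookupOr-upTo (bm m) q n (Columns.len cols))
    where
    cols : Columns q
    cols = IsColumns⇒ q ok
    β : Choice
    β = choiceOf q
    same-letter : ∀ i j → i < m → j < n → letterAt β i j ≡ column q j ‼ i
    same-letter i j i<m j<n = trans
      (cong₂ (λ up dn → letterWith up dn (leftAt β i j) (rightAt β i j)) (sym up≡) (sym down≡))
      (trans (cong₂ (letterWith _ _) (sym left≡) (sym right≡)) (letterWith-ends _))
      where
      open HasEnds (choiceOf-ends q cols i j i<m j<n)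
    same-column : ∀ j → j < n → tabulateW m (λ i → letterAt (decode (encode β)) i j) ≡ column q j
    same-column j j<n = tabulateW-‼ _ (column q j) (λ i i<m →
      trans (letterAt-cong (decode (encode β)) β (decode-encode β) i j i<m j<n) (same-letter i j i<m j<n))

  IsColumns-columnSeq : ∀ q → IsColumns q ≡ true → ColumnSeq n q
  IsColumns-columnSeq q ok with ∧-true {length q ≡ᵇ n} ok
  ... | len-ok , rest = ≡ᵇ≡true⇒≡ len-ok , all≡true⇒ isVertex q (proj₁ (∧-true {all isVertex q} rest))

  twoFactors≡validColumns : numTwoFactors m n edges ≡ sumOver (columnSeqs n) (ind ∘ validColumns)
  twoFactors≡validColumns = begin
      length (filterᵇ (isTwoFactor m n edges) (selections (length edges)))
    ≡⟨ length-filter (isTwoFactor m n edges) (selections (length edges)) ⟩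
      sumOver (selections (length edges)) (ind ∘ isTwoFactor m n edges)
    ≡⟨ cong (λ r → sumOver (selections r) (ind ∘ isTwoFactor m n edges)) length-edges ⟩
      sumOver (selections edgeCount) (ind ∘ isTwoFactor m n edges)
    ≡⟨ sumOver-congᴬ (All.map (λ {s} len → cong (λ x → ind (x ∧ isTwoFactor m n edges s)) (sym (≡⇒≡ᵇ≡true len))) (length-selections edgeCount)) ⟩
      sumOver (selections edgeCount) (ind ∘ IsTwoFactor)
    ≡⟨ count-by-bijection (selections edgeCount) (columnSeqs n) IsTwoFactor IsColumns (eqList eqBool) (eqList eqW)
         (eqList⇒≡ eqBool eqBool⇒≡) (eqList-refl eqBool eqBool-refl) (eqList⇒≡ eqW eqW⇒≡) (eqList-refl eqW eqW-refl)
         (λ s ok → selections-once edgeCount s (proj₁ (IsTwoFactor⇒ s ok)))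
         (λ q ok → columnSeqs-once n q (IsColumns-columnSeq q ok))
         decodeColumns encodeColumns decodeColumns-columns encodeColumns-twoFactor
         encode-decodeColumns decodeColumns-encode ⟩
      sumOver (columnSeqs n) (ind ∘ IsColumns)
    ≡⟨ sumOver-congᴬ (All.map (λ {q} (len , vq) → cong₂ (λ x y → ind (x ∧ (y ∧ validColumns q)))
         (≡⇒≡ᵇ≡true len) (all≡true⇐ isVertex q vq)) (columnSeqs-sound n)) ⟩
      sumOver (columnSeqs n) (ind ∘ validColumns)
    ∎

  ind-chainOK : ∀ x q w → ind (chainOK x q w) ≡ chainWeight x q w
  ind-chainOK x [] w = refl
  ind-chainOK x (y ∷ q) w = trans (ind-∧ (vAll lrArc x y) (chainOK y q w)) (cong (ind (vAll lrArc x y) *_) (ind-chainOK y q w))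

  twoFactors≡sum : numTwoFactors m n edges ≡ sumOver (verts m) (λ x → ind (openLeft x) * aK m n x (glue x))
  twoFactors≡sum = begin
      numTwoFactors m n edges
    ≡⟨ twoFactors≡validColumns ⟩
      sumOver (concatMap (λ x → map (x ∷_) (columnSeqs n′)) (verts m)) (ind ∘ validColumns)
    ≡⟨ sumOver-concatMap (λ x → map (x ∷_) (columnSeqs n′)) (verts m) (ind ∘ validColumns) ⟩
      sumOver (verts m) (λ x → sumOver (map (x ∷_) (columnSeqs n′)) (ind ∘ validColumns))
    ≡⟨ sumOver-cong (verts m) (λ x → trans (sumOver-map (x ∷_) (columnSeqs n′) (ind ∘ validColumns))
         (trans (sumOver-cong (columnSeqs n′) (λ q → trans (ind-∧ (openLeft x) _) (cong (ind (openLeft x) *_) (ind-chainOK x q (glue x)))))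
                (sumOver-*ˡ (columnSeqs n′) (ind (openLeft x)) (λ q → chainWeight x q (glue x))))) ⟩
      sumOver (verts m) (λ x → ind (openLeft x) * sumOver (columnSeqs n′) (λ q → chainWeight x q (glue x)))
    ≡⟨ sumOver-congᴬ (All.map (λ {x} vx → cong (ind (openLeft x) *_) (sumOver-chainWeight n′ x (glue x) vx (glue-vertex x vx))) all-vertices) ⟩
      sumOver (verts m) (λ x → ind (openLeft x) * aK m n x (glue x))
    ∎

-- The three families of grids

module Counts (k n′ : ℕ) where
  open Digraph k public

  n : ℕ
  n = suc n′

  tnc-columns : fTnC m n ≡ sumOver (Fm m) (λ u → aK m n u u)
  tnc-columns = begin
      numTwoFactors m n (edgesTnC m n)
    ≡⟨ cong (numTwoFactors m n) (sym (List.++-identityʳ (edgesTnC m n))) ⟩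
      numTwoFactors m n (edgesTnC m n ++ [])
    ≡⟨ Grid.twoFactors≡sum k n′ false identityTwist ⟩
      sumOver (verts m) (λ u → ind (allIn abc u) * aK m n u u)
    ≡⟨ sym (sumOver-filter (allIn abc) (verts m) (λ u → aK m n u u)) ⟩
      sumOver (Fm m) (λ u → aK m n u u)
    ∎

  tnc-blocks : sumOver (Fm m) (λ u → sumOver (Lm m) (λ w → aK m n′ u w)) ≡ sumOver (Fm m) (λ u → aK m n u u)
  tnc-blocks = sumOver-congᴬ (All.map (λ {u} u-abc →
    trans (sumOver-filter (allIn bdf) (verts m) (λ w → aK m n′ u w))
    (sumOver-cong (verts m) (λ w → trans (*-comm (ind (allIn bdf w)) _) (cong (λ x → aK m n′ u w * ind x) (sym (arc-into-noLeft u w u-abc))))))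
    (All-filterᵇ (allIn abc) (verts m)))

  -- b^m has neither left nor right ends, so the first step of a walk from b^m enters F_m and
  -- the last step into b^m leaves L_m.
  tnc-corner : aK m (n + 1) (bm m) (bm m) ≡ sumOver (Fm m) (λ u → sumOver (Lm m) (λ w → aK m n′ u w))
  tnc-corner = begin
      aK m (n + 1) bb bb
    ≡⟨ cong (λ r → aK m r bb bb) (+-comm n 1) ⟩
      sumOver (verts m) (λ v → aK m n bb v * Tm m v bb)
    ≡⟨ sumOver-congᴬ (All.map (λ {v} vv → cong₂ _*_
         (trans (powM-sucˡ (Tm m) n′ bb v (bm-vertex {k}) vv)
                (sumOver-cong (verts m) (λ w → cong (λ x → ind x * aK m n′ w v) (arc-from-noRight bb w bb-bdf))))
         (cong ind (arc-into-noLeft bb v bb-abc))) all-vertices) ⟩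
      sumOver (verts m) (λ v → sumOver (verts m) (λ w → ind (allIn abc w) * aK m n′ w v) * ind (allIn bdf v))
    ≡⟨ sumOver-cong (verts m) (λ v → trans (sym (sumOver-*ʳ (verts m) (ind (allIn bdf v)) _))
         (sumOver-cong (verts m) (λ w → x*y*z≡x*[z*y] (ind (allIn abc w)) (aK m n′ w v) _))) ⟩
      sumOver (verts m) (λ v → sumOver (verts m) (λ w → ind (allIn abc w) * (ind (allIn bdf v) * aK m n′ w v)))
    ≡⟨ sumOver-swap (verts m) (verts m) _ ⟩
      sumOver (verts m) (λ w → sumOver (verts m) (λ v → ind (allIn abc w) * (ind (allIn bdf v) * aK m n′ w v)))
    ≡⟨ sumOver-cong (verts m) (λ w → trans (sumOver-*ˡ (verts m) (ind (allIn abc w)) _)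
         (cong (ind (allIn abc w) *_) (sym (sumOver-filter (allIn bdf) (verts m) (aK m n′ w))))) ⟩
      sumOver (verts m) (λ w → ind (allIn abc w) * sumOver (Lm m) (aK m n′ w))
    ≡⟨ sym (sumOver-filter (allIn abc) (verts m) (λ w → sumOver (Lm m) (aK m n′ w))) ⟩
      sumOver (Fm m) (λ u → sumOver (Lm m) (λ w → aK m n′ u w))
    ∎
    where
    bb : Word m
    bb = bm m
    bb-abc : allIn abc bb ≡ true
    bb-abc = allIn-replicate-b m abc refl
    bb-bdf : allIn bdf bb ≡ true
    bb-bdf = allIn-replicate-b m bdf refl
    x*y*z≡x*[z*y] : ∀ x y z → x * y * z ≡ x * (z * y)
    x*y*z≡x*[z*y] = solve-∀

  sumPairsIf-rhoP : ∀ (h : Word m → Word m) → (∀ u → Vertex u → Vertex (h u)) → ∀ p (M : Mat m) →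
    sumPairsIf m (λ u w → eqW (h u) (rhoP p w)) M ≡ sumOver (verts m) (λ u → M u (rhoInvP p (h u)))
  sumPairsIf-rhoP h h-vertex p M = sumOver-congᴬ (All.map (λ {u} vu → begin
      sumOver (verts m) (λ w → if eqW (h u) (rhoP p w) then M u w else 0)
    ≡⟨ sumOver-cong (verts m) (λ w → trans (ind-if (eqW (h u) (rhoP p w)) (M u w)) (cong (λ x → ind x * M u w) (eqW-rhoP p (h u) w))) ⟩
      sumOver (verts m) (λ w → ind (eqW w (rhoInvP p (h u))) * M u w)
    ≡⟨ sumOver-verts-select (rhoInvP p (h u)) (M u) (rhoInvP-vertex p (h u) (h-vertex u vu)) ⟩
      M u (rhoInvP p (h u))
    ∎) all-vertices)

  twisted-count : ∀ (tw : Twist k) → numTwoFactors m n (edgesTnC m n ++ map (Grid.closingEdge k n′ true tw) (upTo m))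
                                    ≡ sumOver (verts m) (λ u → aK m n u (Twist.glue tw u))
  twisted-count tw = trans (Grid.twoFactors≡sum k n′ true tw) (sumOver-cong (verts m) (λ u → +-identityʳ _))

  tg-pairs : ∀ p → fTG m p n ≡ sumPairsIf m (λ u w → eqW u (rhoP p w)) (aK m n)
  tg-pairs p = trans (twisted-count (torusTwist p)) (sym (sumPairsIf-rhoP id (λ _ vu → vu) p (aK m n)))

  tg-trace : ∀ p → trM m (mulM m (powM m (Tm m) n) (powM m (Rm m) p)) ≡ sumPairsIf m (λ u w → eqW u (rhoP p w)) (aK m n)
  tg-trace p = sumOver-cong (verts m) (λ u → sumOver-congᴬ (All.map (λ {v} vv →
    trans (cong (aK m n u v *_) (powM-Rm p v u vv)) (trans (*-comm (aK m n u v) _) (sym (ind-if (eqW u (rhoP p v)) (aK m n u v)))))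
    all-vertices))

  kb-pairs : ∀ p → fKB m p n ≡ sumPairsIf m (λ u w → eqW (conv u) (rhoP p w)) (aK m n)
  kb-pairs p = trans (twisted-count (kleinTwist p)) (sym (sumPairsIf-rhoP conv conv-vertex p (aK m n)))

  kb-trace : ∀ p → trM m (mulM m (mulM m (powM m (Tm m) n) (powM m (Rm m) p)) (Hm m)) ≡ sumPairsIf m (λ u w → eqW (conv u) (rhoP p w)) (aK m n)
  kb-trace p = sumOver-cong (verts m) (λ u → begin
      sumOver (verts m) (λ v → sumOver (verts m) (λ w → aK m n u w * Rᵖ w v) * ind (eqW v (conv u)))
    ≡⟨ sumOver-cong (verts m) (λ v → trans (sym (sumOver-*ʳ (verts m) _ (λ w → aK m n u w * Rᵖ w v)))
         (sumOver-cong (verts m) (λ w → *-assoc (aK m n u w) _ _))) ⟩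
      sumOver (verts m) (λ v → sumOver (verts m) (λ w → aK m n u w * (Rᵖ w v * ind (eqW v (conv u)))))
    ≡⟨ sumOver-swap (verts m) (verts m) _ ⟩
      sumOver (verts m) (λ w → sumOver (verts m) (λ v → aK m n u w * (Rᵖ w v * ind (eqW v (conv u)))))
    ≡⟨ sumOver-congᴬ (All.map (λ {w} vw → trans (sumOver-*ˡ (verts m) (aK m n u w) _)
         (trans (cong (aK m n u w *_) (rotated-conv u w vw))
         (trans (*-comm (aK m n u w) _) (sym (ind-if (eqW (conv u) (rhoP p w)) (aK m n u w)))))) all-vertices) ⟩
      sumOver (verts m) (λ w → if eqW (conv u) (rhoP p w) then aK m n u w else 0)
    ∎)
    where
    Rᵖ : Mat m
    Rᵖ = powM m (Rm m) p
    rotated-conv : ∀ u w → Vertex w → sumOver (verts m) (λ v → Rᵖ w v * ind (eqW v (conv u))) ≡ ind (eqW (conv u) (rhoP p w))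
    rotated-conv u w vw = begin
        sumOver (verts m) (λ v → Rᵖ w v * ind (eqW v (conv u)))
      ≡⟨ sumOver-cong (verts m) (λ v → cong (_* ind (eqW v (conv u))) (powM-Rm p w v vw)) ⟩
        sumOver (verts m) (λ v → ind (eqW v (rhoP p w)) * ind (eqW v (conv u)))
      ≡⟨ sumOver-verts-select (rhoP p w) (λ v → ind (eqW v (conv u))) (rhoP-vertex p w vw) ⟩
        ind (eqW (rhoP p w) (conv u))
      ≡⟨ cong ind (eqW-sym (rhoP p w) (conv u)) ⟩
        ind (eqW (conv u) (rhoP p w))
      ∎

  kb-trace-comm : ∀ p → trM m (mulM m (mulM m (powM m (Rm m) p) (Hm m)) (powM m (Tm m) n))
                      ≡ trM m (mulM m (mulM m (powM m (Tm m) n) (powM m (Rm m) p)) (Hm m))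
  kb-trace-comm p = trans (trM-comm (mulM m (powM m (Rm m) p) (Hm m)) (powM m (Tm m) n))
    (sumOver-cong (verts m) (λ u → sym (mulM-assoc (powM m (Tm m) n) (powM m (Rm m) p) (Hm m) u u)))

lemma3 : (m n p : ℕ) → 2 ≤ m → 1 ≤ n → p < m →
    (fTnC m n ≡ sumOver (Fm m) (λ u → sumOver (Lm m) (λ w → aK m (n ∸ 1) u w))
      × fTnC m n ≡ sumOver (Fm m) (λ u → aK m n u u)
      × fTnC m n ≡ aK m (n + 1) (bm m) (bm m))
    × (fTG m p n ≡ trM m (mulM m (powM m (Tm m) n) (powM m (Rm m) p))
      × fTG m p n ≡ trM m (mulM m (powM m (Rm m) p) (powM m (Tm m) n))
      × fTG m p n ≡ sumPairsIf m (λ u w → eqW u (rhoP p w)) (aK m n))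
    × (fKB m p n ≡ trM m (mulM m (mulM m (powM m (Tm m) n) (powM m (Rm m) p)) (Hm m))
      × fKB m p n ≡ trM m (mulM m (mulM m (powM m (Rm m) p) (Hm m)) (powM m (Tm m) n))
      × fKB m p n ≡ sumPairsIf m (λ u w → eqW (conv u) (rhoP p w)) (aK m n))
lemma3 zero n p () _ _
lemma3 (suc k) zero p _ () _
lemma3 (suc k) (suc n′) p _ _ _ =
  ( (trans tnc-columns (sym tnc-blocks) , tnc-columns , trans tnc-columns (trans (sym tnc-blocks) (sym tnc-corner)))
  , (tg , trans tg (sym (trM-comm (powM m (Rm m) p) (powM m (Tm m) n))) , tg-pairs p)
  , (kb , trans kb (sym (kb-trace-comm p)) , kb-pairs p) )
  where
  open Counts k n′
  tg : fTG m p n ≡ trM m (mulM m (powM m (Tm m) n) (powM m (Rm m) p))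
  tg = trans (tg-pairs p) (sym (tg-trace p))
  kb : fKB m p n ≡ trM m (mulM m (mulM m (powM m (Tm m) n) (powM m (Rm m) p)) (Hm m))
  kb = trans (kb-pairs p) (sym (kb-trace p))
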